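{- Let $G$ be a double broom on $n$ vertices with diameter $d$, with $\ell$ left leaves and $r$ right leaves (so $n=d+\ell+r-1$), and geodesic $v_0,\dots,v_d$. Then $$H(\pi,v_d)=\frac{1}{6(n-1)}\Big(4d^3+12d^2(\ell-1)+d\big(12\ell(\ell-2)+24r-13\big)+3\big(-4\ell^2+\ell(8r-3)+r(4r-19)+14\big)\Big).$$
   Context: For a connected graph $G=(V,E)$, $H(u,v)$ denotes the expected number of steps for the simple random walk (moving to a uniformly random neighbour at each step) started at $u$ to first reach $v$ (with $H(u,u)=0$), $\pi_u=\deg(u)/(2|E|)$ is the stationary distribution, and $H(\pi,v)=\sum_{u\in V}\pi_uH(u,v)$. A double broom with diameter $d$ consists of a path $v_1,\dots,v_{d-1}$ together with $\ell\ge1$ pendant edges (the left leaves) attached at $v_1$ and $r\ge1$ pendant edges (the right leaves) attached at $v_{d-1}$; one left leaf is labelled $v_0$ and one right leaf is labelled $v_d$. -}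

module Defs where

open import Data.Bool using (Bool; true; false; _∧_; _∨_; if_then_else_)
open import Data.Nat using (ℕ; zero; suc; _+_; _*_; _∸_; _<ᵇ_; _≡ᵇ_)
open import Data.Fin using (Fin; toℕ)
import Data.Fin as F
open import Data.Integer using (ℤ; +_; -_) renaming (_+_ to _+ℤ_; _*_ to _*ℤ_; _-_ to _-ℤ_)
open import Data.Rational using (ℚ; 0ℚ; 1ℚ; _/_) renaming (_+_ to _+ℚ_; _*_ to _*ℚ_)
open import Relation.Binary.PropositionalEquality using (_≡_; _≢_)
open import Data.Product using (_×_)

Graph : ℕ → Set
Graph n = Fin n → Fin n → Bool

sumℚ : {n : ℕ} → (Fin n → ℚ) → ℚ
sumℚ {zero}  f = 0ℚ
sumℚ {suc n} f = f F.zero +ℚ sumℚ (λ i → f (F.suc i))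

sumℕ : {n : ℕ} → (Fin n → ℕ) → ℕ
sumℕ {zero}  f = 0
sumℕ {suc n} f = f F.zero + sumℕ (λ i → f (F.suc i))

ℕtoℚ : ℕ → ℚ
ℕtoℚ m = (+ m) / 1

ℤtoℚ : ℤ → ℚ
ℤtoℚ z = z / 1

-- division of a rational by a natural number (total; dividing by 0 gives 0,
-- which never happens in the uses below)
divℕ : ℚ → ℕ → ℚ
divℕ q zero    = 0ℚ
divℕ q (suc k) = q *ℚ ((+ 1) / suc k)

deg : {n : ℕ} → Graph n → Fin n → ℕ
deg G u = sumℕ (λ w → if G u w then 1 else 0)

twiceEdges : {n : ℕ} → Graph n → ℕ
twiceEdges G = sumℕ (deg G)

-- h is the vector of expected hitting times (H(u,v))_u of v for the simple
-- random walk on G: the (unique, for connected G) solution of the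
-- first-step equations  H(v,v) = 0,
--   H(u,v) = 1 + (1/deg u) Σ_{w ~ u} H(w,v)   for u ≠ v.
IsHittingTimeTo : {n : ℕ} → Graph n → Fin n → (Fin n → ℚ) → Set
IsHittingTimeTo G v h =
  (h v ≡ 0ℚ) ×
  (∀ u → u ≢ v →
     h u ≡ 1ℚ +ℚ divℕ (sumℚ (λ w → if G u w then h w else 0ℚ)) (deg G u))

-- H(π,v) = Σ_u π_u H(u,v), with π_u = deg u / 2|E|
Hπ : {n : ℕ} → Graph n → (Fin n → ℚ) → ℚ
Hπ G h = divℕ (sumℚ (λ u → ℕtoℚ (deg G u) *ℚ h u)) (twiceEdges G)

-- Index i < d-1 is the path vertex v_{i+1};
-- indices d-1 ≤ i < d-1+ℓ are the left leaves (attached to v_1 = index 0);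
-- indices i ≥ d-1+ℓ are the right leaves (attached to v_{d-1} = index d-2).

broomSize : ℕ → ℕ → ℕ → ℕ
broomSize d ℓ r = (d ∸ 1) + ℓ + r

isPathV : ℕ → ℕ → ℕ → ℕ → Bool
isPathV d ℓ r i = i <ᵇ (d ∸ 1)

isLeftV : ℕ → ℕ → ℕ → ℕ → Bool
isLeftV d ℓ r i = ((d ∸ 1) <ᵇ suc i) ∧ (i <ᵇ (d ∸ 1) + ℓ)

isRightV : ℕ → ℕ → ℕ → ℕ → Bool
isRightV d ℓ r i = ((d ∸ 1) + ℓ) <ᵇ suc i

edgeDir : ℕ → ℕ → ℕ → ℕ → ℕ → Bool
edgeDir d ℓ r i j =
  (isPathV d ℓ r i ∧ isPathV d ℓ r j ∧ (j ≡ᵇ suc i)) ∨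
  ((isLeftV d ℓ r j ∧ (i ≡ᵇ 0)) ∨
   (isRightV d ℓ r j ∧ (i ≡ᵇ (d ∸ 2))))

doubleBroom : (d ℓ r : ℕ) → Graph (broomSize d ℓ r)
doubleBroom d ℓ r u w =
  edgeDir d ℓ r (toℕ u) (toℕ w) ∨ edgeDir d ℓ r (toℕ w) (toℕ u)

-- A right leaf, i.e. a possible choice of v_d.
IsRightLeaf : (d ℓ r : ℕ) → Fin (broomSize d ℓ r) → Set
IsRightLeaf d ℓ r v = isRightV d ℓ r (toℕ v) ≡ true

broomNumerator : ℕ → ℕ → ℕ → ℤ
broomNumerator d ℓ r =
  (+ 4) *ℤ D *ℤ D *ℤ D
  +ℤ (+ 12) *ℤ D *ℤ D *ℤ (L -ℤ + 1)
  +ℤ D *ℤ ((+ 12) *ℤ L *ℤ (L -ℤ + 2) +ℤ (+ 24) *ℤ R -ℤ + 13)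
  +ℤ (+ 3) *ℤ (- ((+ 4) *ℤ L *ℤ L) +ℤ L *ℤ ((+ 8) *ℤ R -ℤ + 3)
               +ℤ R *ℤ ((+ 4) *ℤ R -ℤ + 19) +ℤ + 14)
  where
  D = + d
  L = + ℓ
  R = + r

broomFormula : ℕ → ℕ → ℕ → ℚ
broomFormula d ℓ r = divℕ (ℤtoℚ (broomNumerator d ℓ r)) (6 * (d + ℓ + r ∸ 1 ∸ 1))

{-# OPTIONS --safe #-}
module Submission where

-- The hitting-time equations of the double broom can be solved in closed form. A left leaf has
-- H = 1 + H(v₁) and every right leaf other than v_d has H = 1 + H(v_{d−1}); given these, the
-- first-step equations along the path are equivalent to the recurrence
-- H(v_j) = H(v_{j+1}) + 2(ℓ + j) − 1 with H(v_{d−1}) = 2|E| − 1, whose unique solution is a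
-- quadratic in j. As every step is an equivalence, this explicit function is the unique
-- solution; summing deg·H over it and dividing by 2|E| = 2(n − 1) gives the formula.

open import Defs
open import Data.Bool using (Bool; true; false; if_then_else_; _∨_)
open import Data.Bool.Properties using (T-≡; ∧-zeroʳ)
open import Data.Empty using (⊥-elim)
open import Data.Fin as Fin using (Fin; toℕ)
import Data.Fin.Properties as Finₚ
open import Data.Integer as ℤ using (ℤ)
import Data.Integer.Properties as ℤₚ
open import Data.Nat as ℕ using (ℕ; zero; suc; z≤n; s≤s; _≤_; _<_; _≡ᵇ_; _<ᵇ_)
import Data.Nat.Properties as ℕₚ
open import Data.Product using (_×_; _,_; ∃)
open import Data.Rational as ℚ using (ℚ; 0ℚ; 1ℚ; _+_; _*_; _-_; -_; toℚᵘ)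
import Data.Rational.Properties as ℚₚ
import Data.Rational.Unnormalised as ℚᵘ
import Data.Rational.Unnormalised.Properties as ℚᵘₚ
open import Data.Sum using (inj₁; inj₂)
open import Function using (_⇔_; mk⇔; Equivalence; id; _∘_)
open import Function.Properties.Equivalence using () renaming (trans to ⇔-trans)
open import Relation.Binary.PropositionalEquality
open import Relation.Nullary using (yes; no)
open import Relation.Nullary.Decidable.Core using (dec⇒maybe)
import Tactic.RingSolver as RingSolver
import Tactic.RingSolver.Core.AlmostCommutativeRing as ACR
open import Algebra.Properties.Group ℚₚ.+-0-group using (x∙y⁻¹≈ε⇒x≈y)

open Equivalence using (to; from)

ℚ-ring : ACR.AlmostCommutativeRing _ _
ℚ-ring = ACR.fromCommutativeRing ℚₚ.+-*-commutativeRing (λ x → dec⇒maybe (0ℚ ℚₚ.≟ x))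

≡-difference⇔ : ∀ {a b c d : ℚ} → a - b ≡ c - d → (a ≡ b) ⇔ (c ≡ d)
≡-difference⇔ {a} {b} {c} {d} a-b≡c-d =
  mk⇔ (λ a≡b → x∙y⁻¹≈ε⇒x≈y c d (trans (sym a-b≡c-d) (difference-zero a≡b)))
      (λ c≡d → x∙y⁻¹≈ε⇒x≈y a b (trans a-b≡c-d (difference-zero c≡d)))
  where
  difference-zero : ∀ {x y} → x ≡ y → x - y ≡ 0ℚ
  difference-zero {x} refl = ℚₚ.+-inverseʳ x

toℚᵘ-/ : ∀ i k → toℚᵘ (i ℚ./ suc k) ℚᵘ.≃ ℚᵘ.mkℚᵘ i k
toℚᵘ-/ i k = ℚₚ.toℚᵘ-fromℚᵘ (ℚᵘ.mkℚᵘ i k)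

ℤtoℚ-+ : ∀ i j → ℤtoℚ (i ℤ.+ j) ≡ ℤtoℚ i + ℤtoℚ j
ℤtoℚ-+ i j = ℚₚ.toℚᵘ-injective (begin
  toℚᵘ (ℤtoℚ (i ℤ.+ j))            ≈⟨ toℚᵘ-/ (i ℤ.+ j) 0 ⟩
  ℚᵘ.mkℚᵘ (i ℤ.+ j) 0
    ≈⟨ ℚᵘ.*≡* (cong (ℤ._* ℤ.+ 1) (sym (cong₂ ℤ._+_ (ℤₚ.*-identityʳ i) (ℤₚ.*-identityʳ j)))) ⟩
  ℚᵘ.mkℚᵘ i 0 ℚᵘ.+ ℚᵘ.mkℚᵘ j 0      ≈⟨ ℚᵘₚ.+-cong (toℚᵘ-/ i 0) (toℚᵘ-/ j 0) ⟨
  toℚᵘ (ℤtoℚ i) ℚᵘ.+ toℚᵘ (ℤtoℚ j)  ≈⟨ ℚₚ.toℚᵘ-homo-+ (ℤtoℚ i) (ℤtoℚ j) ⟨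
  toℚᵘ (ℤtoℚ i + ℤtoℚ j)            ∎)
  where open ℚᵘₚ.≃-Reasoning

ℤtoℚ-* : ∀ i j → ℤtoℚ (i ℤ.* j) ≡ ℤtoℚ i * ℤtoℚ j
ℤtoℚ-* i j = ℚₚ.toℚᵘ-injective (begin
  toℚᵘ (ℤtoℚ (i ℤ.* j))            ≈⟨ toℚᵘ-/ (i ℤ.* j) 0 ⟩
  ℚᵘ.mkℚᵘ i 0 ℚᵘ.* ℚᵘ.mkℚᵘ j 0      ≈⟨ ℚᵘₚ.*-cong (toℚᵘ-/ i 0) (toℚᵘ-/ j 0) ⟨
  toℚᵘ (ℤtoℚ i) ℚᵘ.* toℚᵘ (ℤtoℚ j)  ≈⟨ ℚₚ.toℚᵘ-homo-* (ℤtoℚ i) (ℤtoℚ j) ⟨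
  toℚᵘ (ℤtoℚ i * ℤtoℚ j)            ∎)
  where open ℚᵘₚ.≃-Reasoning

ℤtoℚ-neg : ∀ i → ℤtoℚ (ℤ.- i) ≡ - ℤtoℚ i
ℤtoℚ-neg i = ℚₚ.toℚᵘ-injective (begin
  toℚᵘ (ℤtoℚ (ℤ.- i))     ≈⟨ toℚᵘ-/ (ℤ.- i) 0 ⟩
  ℚᵘ.- ℚᵘ.mkℚᵘ i 0         ≈⟨ ℚᵘₚ.-‿cong (toℚᵘ-/ i 0) ⟨
  ℚᵘ.- toℚᵘ (ℤtoℚ i)       ≈⟨ ℚₚ.toℚᵘ-homo‿- (ℤtoℚ i) ⟨
  toℚᵘ (- ℤtoℚ i)          ∎)
  where open ℚᵘₚ.≃-Reasoning

ℕtoℚ-+ : ∀ a b → ℕtoℚ (a ℕ.+ b) ≡ ℕtoℚ a + ℕtoℚ b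
ℕtoℚ-+ a b = ℤtoℚ-+ (ℤ.+ a) (ℤ.+ b)

ℕtoℚ-* : ∀ a b → ℕtoℚ (a ℕ.* b) ≡ ℕtoℚ a * ℕtoℚ b
ℕtoℚ-* a b = trans (cong ℤtoℚ (ℤₚ.pos-* a b)) (ℤtoℚ-* (ℤ.+ a) (ℤ.+ b))

ℕtoℚ-suc : ∀ a → ℕtoℚ (suc a) ≡ 1ℚ + ℕtoℚ a
ℕtoℚ-suc = ℕtoℚ-+ 1

ℕtoℚ-suc≢0 : ∀ k → ℕtoℚ (suc k) ≢ 0ℚ
ℕtoℚ-suc≢0 k = ≢-sym (ℚₚ.<⇒≢ (ℚₚ.positive⁻¹ (ℕtoℚ (suc k)) {{ℚₚ.normalize-pos (suc k) 1}}))

ℕtoℚ-*-reciprocal : ∀ k → ℕtoℚ (suc k) * (ℤ.+ 1 ℚ./ suc k) ≡ 1ℚ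
ℕtoℚ-*-reciprocal k = ℚₚ.toℚᵘ-injective (begin
  toℚᵘ (ℕtoℚ (suc k) * (ℤ.+ 1 ℚ./ suc k))         ≈⟨ ℚₚ.toℚᵘ-homo-* (ℕtoℚ (suc k)) (ℤ.+ 1 ℚ./ suc k) ⟩
  toℚᵘ (ℕtoℚ (suc k)) ℚᵘ.* toℚᵘ (ℤ.+ 1 ℚ./ suc k)  ≈⟨ ℚᵘₚ.*-cong (toℚᵘ-/ (ℤ.+ (suc k)) 0) (toℚᵘ-/ (ℤ.+ 1) k) ⟩
  ℚᵘ.mkℚᵘ (ℤ.+ (suc k)) 0 ℚᵘ.* ℚᵘ.mkℚᵘ (ℤ.+ 1) k        ≈⟨ ℚᵘₚ.*-inverseʳ (ℚᵘ.mkℚᵘ (ℤ.+ (suc k)) 0) ⟩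
  ℚᵘ.1ℚᵘ                                          ∎)
  where open ℚᵘₚ.≃-Reasoning

divℕ-*-cancel : ∀ s k → ℕtoℚ k ≢ 0ℚ → divℕ s k * ℕtoℚ k ≡ s
divℕ-*-cancel s zero    k≢0 = ⊥-elim (k≢0 refl)
divℕ-*-cancel s (suc k) _   = begin
  s * k⁻¹ * ℕtoℚ (suc k)    ≡⟨ ℚₚ.*-assoc s k⁻¹ (ℕtoℚ (suc k)) ⟩
  s * (k⁻¹ * ℕtoℚ (suc k))  ≡⟨ cong (s *_) (trans (ℚₚ.*-comm k⁻¹ (ℕtoℚ (suc k))) (ℕtoℚ-*-reciprocal k)) ⟩
  s * 1ℚ                    ≡⟨ ℚₚ.*-identityʳ s ⟩
  s                         ∎
  where
  open ≡-Reasoning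
  k⁻¹ = ℤ.+ 1 ℚ./ suc k

divℕ-unique : ∀ s k x → ℕtoℚ k ≢ 0ℚ → x * ℕtoℚ k ≡ s → divℕ s k ≡ x
divℕ-unique s zero    x k≢0 _     = ⊥-elim (k≢0 refl)
divℕ-unique s (suc k) x _   x*k≡s = begin
  s * k⁻¹                    ≡⟨ cong (_* k⁻¹) x*k≡s ⟨
  x * ℕtoℚ (suc k) * k⁻¹     ≡⟨ ℚₚ.*-assoc x (ℕtoℚ (suc k)) k⁻¹ ⟩
  x * (ℕtoℚ (suc k) * k⁻¹)   ≡⟨ cong (x *_) (ℕtoℚ-*-reciprocal k) ⟩
  x * 1ℚ                     ≡⟨ ℚₚ.*-identityʳ x ⟩
  x                          ∎
  where
  open ≡-Reasoning
  k⁻¹ = ℤ.+ 1 ℚ./ suc k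

first-step⇔ : ∀ x s k → ℕtoℚ k ≢ 0ℚ → (x ≡ 1ℚ + divℕ s k) ⇔ (x * ℕtoℚ k ≡ ℕtoℚ k + s)
first-step⇔ x s k k≢0 = mk⇔ cleared restored
  where
  open ≡-Reasoning
  cleared : x ≡ 1ℚ + divℕ s k → x * ℕtoℚ k ≡ ℕtoℚ k + s
  cleared refl = begin
    (1ℚ + divℕ s k) * ℕtoℚ k              ≡⟨ ℚₚ.*-distribʳ-+ (ℕtoℚ k) 1ℚ (divℕ s k) ⟩
    1ℚ * ℕtoℚ k + divℕ s k * ℕtoℚ k        ≡⟨ cong₂ _+_ (ℚₚ.*-identityˡ (ℕtoℚ k)) (divℕ-*-cancel s k k≢0) ⟩
    ℕtoℚ k + s                            ∎
  restored : x * ℕtoℚ k ≡ ℕtoℚ k + s → x ≡ 1ℚ + divℕ s k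
  restored x*k≡k+s = begin
    x                    ≡⟨ x≡1+[x-1] x ⟩
    1ℚ + (x - 1ℚ)        ≡⟨ cong (1ℚ +_) (divℕ-unique s k (x - 1ℚ) k≢0 (begin
      (x - 1ℚ) * ℕtoℚ k        ≡⟨ [x-1]*k≡x*k-k x (ℕtoℚ k) ⟩
      x * ℕtoℚ k - ℕtoℚ k      ≡⟨ cong (_- ℕtoℚ k) x*k≡k+s ⟩
      ℕtoℚ k + s - ℕtoℚ k      ≡⟨ k+s-k≡s (ℕtoℚ k) s ⟩
      s                        ∎)) ⟨
    1ℚ + divℕ s k        ∎
    where
    x≡1+[x-1] : ∀ x → x ≡ 1ℚ + (x - 1ℚ)
    x≡1+[x-1] = RingSolver.solve-∀ ℚ-ring
    [x-1]*k≡x*k-k : ∀ x k → (x - 1ℚ) * k ≡ x * k - k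
    [x-1]*k≡x*k-k = RingSolver.solve-∀ ℚ-ring
    k+s-k≡s : ∀ k s → k + s - k ≡ s
    k+s-k≡s = RingSolver.solve-∀ ℚ-ring

data Poly₃ : Set where
  con        : ℤ → Poly₃
  x₀ x₁ x₂   : Poly₃
  _⊕_ _⊗_    : Poly₃ → Poly₃ → Poly₃
  ⊝_         : Poly₃ → Poly₃

infixl 6 _⊕_
infixl 7 _⊗_

evalℤ : Poly₃ → ℤ → ℤ → ℤ → ℤ
evalℤ (con c) a b e = c
evalℤ x₀      a b e = a
evalℤ x₁      a b e = b
evalℤ x₂      a b e = e
evalℤ (p ⊕ q) a b e = evalℤ p a b e ℤ.+ evalℤ q a b e
evalℤ (p ⊗ q) a b e = evalℤ p a b e ℤ.* evalℤ q a b e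
evalℤ (⊝ p)   a b e = ℤ.- evalℤ p a b e

evalℚ : Poly₃ → ℚ → ℚ → ℚ → ℚ
evalℚ (con c) a b e = ℤtoℚ c
evalℚ x₀      a b e = a
evalℚ x₁      a b e = b
evalℚ x₂      a b e = e
evalℚ (p ⊕ q) a b e = evalℚ p a b e + evalℚ q a b e
evalℚ (p ⊗ q) a b e = evalℚ p a b e * evalℚ q a b e
evalℚ (⊝ p)   a b e = - evalℚ p a b e

ℤtoℚ-evalℤ : ∀ p a b e → ℤtoℚ (evalℤ p a b e) ≡ evalℚ p (ℤtoℚ a) (ℤtoℚ b) (ℤtoℚ e)
ℤtoℚ-evalℤ (con c) a b e = refl
ℤtoℚ-evalℤ x₀      a b e = refl
ℤtoℚ-evalℤ x₁      a b e = refl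
ℤtoℚ-evalℤ x₂      a b e = refl
ℤtoℚ-evalℤ (p ⊕ q) a b e =
  trans (ℤtoℚ-+ (evalℤ p a b e) (evalℤ q a b e)) (cong₂ _+_ (ℤtoℚ-evalℤ p a b e) (ℤtoℚ-evalℤ q a b e))
ℤtoℚ-evalℤ (p ⊗ q) a b e =
  trans (ℤtoℚ-* (evalℤ p a b e) (evalℤ q a b e)) (cong₂ _*_ (ℤtoℚ-evalℤ p a b e) (ℤtoℚ-evalℤ q a b e))
ℤtoℚ-evalℤ (⊝ p)   a b e = trans (ℤtoℚ-neg (evalℤ p a b e)) (cong -_ (ℤtoℚ-evalℤ p a b e))

broomNumeratorPoly : Poly₃
broomNumeratorPoly =
  con (ℤ.+ 4) ⊗ x₀ ⊗ x₀ ⊗ x₀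
  ⊕ con (ℤ.+ 12) ⊗ x₀ ⊗ x₀ ⊗ (x₁ ⊕ ⊝ con (ℤ.+ 1))
  ⊕ x₀ ⊗ (con (ℤ.+ 12) ⊗ x₁ ⊗ (x₁ ⊕ ⊝ con (ℤ.+ 2)) ⊕ con (ℤ.+ 24) ⊗ x₂ ⊕ ⊝ con (ℤ.+ 13))
  ⊕ con (ℤ.+ 3) ⊗ (⊝ (con (ℤ.+ 4) ⊗ x₁ ⊗ x₁) ⊕ x₁ ⊗ (con (ℤ.+ 8) ⊗ x₂ ⊕ ⊝ con (ℤ.+ 3))
                 ⊕ x₂ ⊗ (con (ℤ.+ 4) ⊗ x₂ ⊕ ⊝ con (ℤ.+ 19)) ⊕ con (ℤ.+ 14))

ℤtoℚ-broomNumerator : ∀ d ℓ r →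
  ℤtoℚ (broomNumerator d ℓ r) ≡ evalℚ broomNumeratorPoly (ℕtoℚ d) (ℕtoℚ ℓ) (ℕtoℚ r)
ℤtoℚ-broomNumerator d ℓ r = ℤtoℚ-evalℤ broomNumeratorPoly (ℤ.+ d) (ℤ.+ ℓ) (ℤ.+ r)

sumBelow : ℕ → (ℕ → ℚ) → ℚ
sumBelow zero    g = 0ℚ
sumBelow (suc n) g = g 0 + sumBelow n (λ j → g (suc j))

sumℚ≡sumBelow : ∀ {n} (f : Fin n → ℚ) g → (∀ w → f w ≡ g (toℕ w)) → sumℚ f ≡ sumBelow n g
sumℚ≡sumBelow {zero}  f g f≗g = refl
sumℚ≡sumBelow {suc n} f g f≗g =
  cong₂ _+_ (f≗g Fin.zero) (sumℚ≡sumBelow (λ w → f (Fin.suc w)) (λ j → g (suc j)) (λ w → f≗g (Fin.suc w)))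

ℕtoℚ-sumℕ : ∀ {n} (f : Fin n → ℕ) → ℕtoℚ (sumℕ f) ≡ sumℚ (λ w → ℕtoℚ (f w))
ℕtoℚ-sumℕ {zero}  f = refl
ℕtoℚ-sumℕ {suc n} f = trans (ℕtoℚ-+ (f Fin.zero) _) (cong (ℕtoℚ (f Fin.zero) +_) (ℕtoℚ-sumℕ (λ w → f (Fin.suc w))))

sumBelow-cong : ∀ n {g g′} → (∀ j → j < n → g j ≡ g′ j) → sumBelow n g ≡ sumBelow n g′
sumBelow-cong zero    g≗g′ = refl
sumBelow-cong (suc n) g≗g′ = cong₂ _+_ (g≗g′ 0 (s≤s z≤n)) (sumBelow-cong n (λ j j<n → g≗g′ (suc j) (s≤s j<n)))

sumBelow-+ : ∀ a b g → sumBelow (a ℕ.+ b) g ≡ sumBelow a g + sumBelow b (λ j → g (a ℕ.+ j))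
sumBelow-+ zero    b g = sym (ℚₚ.+-identityˡ _)
sumBelow-+ (suc a) b g =
  trans (cong (g 0 +_) (sumBelow-+ a b (λ j → g (suc j)))) (sym (ℚₚ.+-assoc (g 0) _ _))

sumBelow-zero : ∀ n → sumBelow n (λ _ → 0ℚ) ≡ 0ℚ
sumBelow-zero zero    = refl
sumBelow-zero (suc n) = cong (0ℚ +_) (sumBelow-zero n)

sumBelow-if : ∀ n b g → sumBelow n (λ j → if b then g j else 0ℚ) ≡ (if b then sumBelow n g else 0ℚ)
sumBelow-if n true  g = refl
sumBelow-if n false g = sumBelow-zero n

sumBelow-distrib : ∀ n f g → sumBelow n (λ j → f j + g j) ≡ sumBelow n f + sumBelow n g
sumBelow-distrib zero    f g = refl
sumBelow-distrib (suc n) f g =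
  trans (cong ((f 0 + g 0) +_) (sumBelow-distrib n (λ j → f (suc j)) (λ j → g (suc j))))
        (interchange (f 0) (g 0) _ _)
  where
  interchange : ∀ a b c d → (a + b) + (c + d) ≡ (a + c) + (b + d)
  interchange = RingSolver.solve-∀ ℚ-ring

sumBelow-const : ∀ n c → sumBelow n (λ _ → c) ≡ ℕtoℚ n * c
sumBelow-const zero    c = sym (ℚₚ.*-zeroˡ c)
sumBelow-const (suc n) c = begin
  c + sumBelow n (λ _ → c)   ≡⟨ cong (c +_) (sumBelow-const n c) ⟩
  c + ℕtoℚ n * c             ≡⟨ c+n*c≡[1+n]*c (ℕtoℚ n) c ⟩
  (1ℚ + ℕtoℚ n) * c          ≡⟨ cong (_* c) (ℕtoℚ-suc n) ⟨
  ℕtoℚ (suc n) * c           ∎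
  where
  open ≡-Reasoning
  c+n*c≡[1+n]*c : ∀ n c → c + n * c ≡ (1ℚ + n) * c
  c+n*c≡[1+n]*c = RingSolver.solve-∀ ℚ-ring

sumBelow-snoc : ∀ n g → sumBelow (suc n) g ≡ sumBelow n g + g n
sumBelow-snoc zero    g = trans (ℚₚ.+-identityʳ (g 0)) (sym (ℚₚ.+-identityˡ (g 0)))
sumBelow-snoc (suc n) g =
  trans (cong (g 0 +_) (sumBelow-snoc n (λ j → g (suc j)))) (sym (ℚₚ.+-assoc (g 0) _ _))

sumBelow-δ : ∀ n a f → a < n → sumBelow n (λ j → if j ≡ᵇ a then f j else 0ℚ) ≡ f a
sumBelow-δ (suc n) zero    f _         = trans (cong (f 0 +_) (sumBelow-zero n)) (ℚₚ.+-identityʳ (f 0))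
sumBelow-δ (suc n) (suc a) f (s≤s a<n) = trans (cong (0ℚ +_) (sumBelow-δ n a (λ j → f (suc j)) a<n)) (ℚₚ.+-identityˡ _)

sumBelow-δ-outside : ∀ n a f → n ≤ a → sumBelow n (λ j → if j ≡ᵇ a then f j else 0ℚ) ≡ 0ℚ
sumBelow-δ-outside zero    a       f _         = refl
sumBelow-δ-outside (suc n) (suc a) f (s≤s n≤a) = cong (0ℚ +_) (sumBelow-δ-outside n a (λ j → f (suc j)) n≤a)

sumBelow-except-one : ∀ k t {g} c → t < suc k → (∀ a → a < suc k → a ≢ t → g a ≡ c) → g t ≡ 0ℚ →
  sumBelow (suc k) g ≡ ℕtoℚ k * c
sumBelow-except-one k zero {g} c _ g≡c g0≡0 = begin
  g 0 + sumBelow k (λ j → g (suc j))   ≡⟨ cong₂ _+_ g0≡0 (sumBelow-cong k (λ j j<k → g≡c (suc j) (s≤s j<k) λ ())) ⟩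
  0ℚ + sumBelow k (λ _ → c)            ≡⟨ ℚₚ.+-identityˡ _ ⟩
  sumBelow k (λ _ → c)                 ≡⟨ sumBelow-const k c ⟩
  ℕtoℚ k * c                           ∎
  where open ≡-Reasoning
sumBelow-except-one (suc k) (suc t) {g} c (s≤s t<k) g≡c gt≡0 = begin
  g 0 + sumBelow (suc k) (λ j → g (suc j))
    ≡⟨ cong₂ _+_ (g≡c 0 (s≤s z≤n) λ ())
                 (sumBelow-except-one k t c t<k (λ a a<k a≢t → g≡c (suc a) (s≤s a<k) (a≢t ∘ ℕₚ.suc-injective)) gt≡0) ⟩
  c + ℕtoℚ k * c                             ≡⟨ c+k*c≡[1+k]*c (ℕtoℚ k) c ⟩
  (1ℚ + ℕtoℚ k) * c                          ≡⟨ cong (_* c) (ℕtoℚ-suc k) ⟨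
  ℕtoℚ (suc k) * c                           ∎
  where
  open ≡-Reasoning
  c+k*c≡[1+k]*c : ∀ k c → c + k * c ≡ (1ℚ + k) * c
  c+k*c≡[1+k]*c = RingSolver.solve-∀ ℚ-ring

backward-recurrence-unique : ∀ m (f g s : ℕ → ℚ) →
  (∀ i → i < m → f i ≡ f (suc i) + s i) → (∀ i → i < m → g i ≡ g (suc i) + s i) → f m ≡ g m →
  ∀ i → i ≤ m → f i ≡ g i
backward-recurrence-unique m f g s f-rec g-rec fm≡gm i i≤m = go (m ℕ.∸ i) i (ℕₚ.m+[n∸m]≡n i≤m)
  where
  open ≡-Reasoning
  go : ∀ k i → i ℕ.+ k ≡ m → f i ≡ g i
  go zero    i i+0≡m = subst (λ j → f j ≡ g j) (sym (trans (sym (ℕₚ.+-identityʳ i)) i+0≡m)) fm≡gm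
  go (suc k) i i+1+k≡m = begin
    f i             ≡⟨ f-rec i i<m ⟩
    f (suc i) + s i ≡⟨ cong (_+ s i) (go k (suc i) (trans (sym (ℕₚ.+-suc i k)) i+1+k≡m)) ⟩
    g (suc i) + s i ≡⟨ g-rec i i<m ⟨
    g i             ∎
    where
    i<m : i < m
    i<m = subst (i <_) i+1+k≡m (ℕₚ.m<m+n i (s≤s z≤n))

<ᵇ-true : ∀ {a b} → a < b → (a <ᵇ b) ≡ true
<ᵇ-true a<b = to T-≡ (ℕₚ.<⇒<ᵇ a<b)

<ᵇ-false : ∀ {a b} → b ≤ a → (a <ᵇ b) ≡ false
<ᵇ-false {a} {b} b≤a with a <ᵇ b in eq
... | false = refl
... | true  = ⊥-elim (ℕₚ.<⇒≱ (ℕₚ.<ᵇ⇒< a b (from T-≡ eq)) b≤a)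

≡ᵇ-false : ∀ {a b} → a ≢ b → (a ≡ᵇ b) ≡ false
≡ᵇ-false {a} {b} a≢b with a ≡ᵇ b in eq
... | false = refl
... | true  = ⊥-elim (a≢b (ℕₚ.≡ᵇ⇒≡ a b (from T-≡ eq)))

≡ᵇ-refl : ∀ a → (a ≡ᵇ a) ≡ true
≡ᵇ-refl a = to T-≡ (ℕₚ.≡⇒≡ᵇ a a refl)

≡ᵇ-comm : ∀ a b → (a ≡ᵇ b) ≡ (b ≡ᵇ a)
≡ᵇ-comm zero    zero    = refl
≡ᵇ-comm zero    (suc b) = refl
≡ᵇ-comm (suc a) zero    = refl
≡ᵇ-comm (suc a) (suc b) = ≡ᵇ-comm a b

-- PathVertex m i classifies v_{i+1} for i ≤ m: the single path vertex when d = 2, otherwise v₁,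
-- an inner vertex or v_{d−1}.
data PathVertex : ℕ → ℕ → Set where
  centre : PathVertex 0 0
  first  : ∀ {m} → PathVertex (suc m) 0
  inner  : ∀ {m i} → i < m → PathVertex (suc m) (suc i)
  last   : ∀ {m} → PathVertex (suc m) (suc m)

pathVertex : ∀ {m i} → i ≤ m → PathVertex m i
pathVertex {zero}  {zero}  _         = centre
pathVertex {suc m} {zero}  _         = first
pathVertex {suc m} {suc i} (s≤s i≤m) with ℕₚ.m≤n⇒m<n∨m≡n i≤m
... | inj₁ i<m  = inner i<m
... | inj₂ refl = last

-- The vertices of doubleBroom (m + 2) ℓ r read as natural numbers: i ≤ m is v_{i+1}, then come
-- the ℓ left leaves and then the r right leaves.
module Neighbourhood (ℓ r : ℕ) where

  module _ (m : ℕ) where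

    size : ℕ
    size = suc m ℕ.+ ℓ ℕ.+ r

    target : ℕ → ℕ
    target t′ = suc m ℕ.+ ℓ ℕ.+ t′

    adj : ℕ → ℕ → Bool
    adj i j = edgeDir (suc (suc m)) ℓ r i j ∨ edgeDir (suc (suc m)) ℓ r j i

    nbrSum : (ℕ → ℚ) → ℕ → ℚ
    nbrSum H i = sumBelow size (λ j → if adj i j then H j else 0ℚ)

    leftSum : (ℕ → ℚ) → ℚ
    leftSum H = sumBelow ℓ (λ a → H (suc m ℕ.+ a))

    rightSum : (ℕ → ℚ) → ℚ
    rightSum H = sumBelow r (λ a → H (suc m ℕ.+ ℓ ℕ.+ a))

    data Position : ℕ → Set where
      path  : ∀ {i} → i ≤ m → Position i
      left  : ∀ {i} → m < i → i ≤ m ℕ.+ ℓ → Position i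
      right : ∀ {i} → m ℕ.+ ℓ < i → Position i

    position : ∀ i → Position i
    position i with i ℕ.≤? m | i ℕ.≤? m ℕ.+ ℓ
    ... | yes i≤m | _          = path i≤m
    ... | no i≰m  | yes i≤m+ℓ  = left (ℕₚ.≰⇒> i≰m) i≤m+ℓ
    ... | no _    | no i≰m+ℓ   = right (ℕₚ.≰⇒> i≰m+ℓ)

    left-above : ∀ a → m < suc m ℕ.+ a
    left-above a = s≤s (ℕₚ.m≤m+n m a)

    left-below : ∀ {a} → a < ℓ → suc m ℕ.+ a ≤ m ℕ.+ ℓ
    left-below {a} a<ℓ = ℕₚ.≤-trans (ℕₚ.≤-reflexive (sym (ℕₚ.+-suc m a))) (ℕₚ.+-monoʳ-≤ m a<ℓ)

    right-above : ∀ a → m ℕ.+ ℓ < suc m ℕ.+ ℓ ℕ.+ a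
    right-above a = s≤s (ℕₚ.m≤m+n (m ℕ.+ ℓ) a)

    right<size : ∀ {a} → a < r → suc m ℕ.+ ℓ ℕ.+ a < size
    right<size a<r = ℕₚ.+-monoʳ-< (suc m ℕ.+ ℓ) a<r

    ≤m+ℓ⇒<size : ∀ {i} → i ≤ m ℕ.+ ℓ → i < size
    ≤m+ℓ⇒<size i≤m+ℓ = ℕₚ.≤-trans (s≤s i≤m+ℓ) (ℕₚ.m≤m+n (suc m ℕ.+ ℓ) r)

    ≤m+ℓ⇒≢target : ∀ {i} t′ → i ≤ m ℕ.+ ℓ → i ≢ target t′
    ≤m+ℓ⇒≢target t′ i≤m+ℓ = ℕₚ.<⇒≢ (ℕₚ.≤-<-trans i≤m+ℓ (right-above t′))

    right-leaf≢target : ∀ {a t′} → a ≢ t′ → suc m ℕ.+ ℓ ℕ.+ a ≢ target t′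
    right-leaf≢target {a} {t′} a≢t′ e = a≢t′ (ℕₚ.+-cancelˡ-≡ (suc m ℕ.+ ℓ) a t′ e)

    sumBelow-size : ∀ g → sumBelow size g ≡
      (sumBelow (suc m) g + sumBelow ℓ (λ a → g (suc m ℕ.+ a))) + sumBelow r (λ a → g (suc m ℕ.+ ℓ ℕ.+ a))
    sumBelow-size g = trans (sumBelow-+ (suc m ℕ.+ ℓ) r g)
      (cong (_+ sumBelow r (λ a → g (suc m ℕ.+ ℓ ℕ.+ a))) (sumBelow-+ (suc m) ℓ g))

    private
      onPath : ∀ {k} → k ≤ m → (k <ᵇ suc m) ≡ true
      onPath k≤m = <ᵇ-true (s≤s k≤m)
      offPath : ∀ {j} → m < j → (j <ᵇ suc m) ≡ false
      offPath = <ᵇ-false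
      pastPath : ∀ {j} → m < j → (m <ᵇ j) ≡ true
      pastPath = <ᵇ-true
      notPastPath : ∀ {k} → k ≤ m → (m <ᵇ k) ≡ false
      notPastPath = <ᵇ-false
      beforeRight : ∀ {j} → j ≤ m ℕ.+ ℓ → (j <ᵇ suc (m ℕ.+ ℓ)) ≡ true
      beforeRight j≤m+ℓ = <ᵇ-true (s≤s j≤m+ℓ)
      notBeforeRight : ∀ {j} → m ℕ.+ ℓ < j → (j <ᵇ suc (m ℕ.+ ℓ)) ≡ false
      notBeforeRight = <ᵇ-false
      onRight : ∀ {j} → m ℕ.+ ℓ < j → (m ℕ.+ ℓ <ᵇ j) ≡ true
      onRight = <ᵇ-true
      offRight : ∀ {j} → j ≤ m ℕ.+ ℓ → (m ℕ.+ ℓ <ᵇ j) ≡ false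
      offRight = <ᵇ-false
      notFirst : ∀ {j} → m < j → (j ≡ᵇ 0) ≡ false
      notFirst {suc j} _ = refl
      notLast : ∀ {j} → m < j → (j ≡ᵇ m) ≡ false
      notLast m<j = ≡ᵇ-false (λ j≡m → ℕₚ.<-irrefl (sym j≡m) m<j)
      ≤m⇒≤m+ℓ : ∀ {k} → k ≤ m → k ≤ m ℕ.+ ℓ
      ≤m⇒≤m+ℓ k≤m = ℕₚ.≤-trans k≤m (ℕₚ.m≤m+n m ℓ)
      >m+ℓ⇒>m : ∀ {j} → m ℕ.+ ℓ < j → m < j
      >m+ℓ⇒>m m+ℓ<j = ℕₚ.≤-trans (s≤s (ℕₚ.m≤m+n m ℓ)) m+ℓ<j
      1+1+≢ : ∀ n → n ≢ suc (suc n)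
      1+1+≢ zero    ()
      1+1+≢ (suc n) e = 1+1+≢ n (ℕₚ.suc-injective e)

    adj-path-path : ∀ i k (H : ℕ → ℚ) → i ≤ m → k ≤ m →
      (if adj i k then H k else 0ℚ) ≡ (if k ≡ᵇ suc i then H k else 0ℚ) + (if i ≡ᵇ suc k then H k else 0ℚ)
    adj-path-path i k H i≤m k≤m
      rewrite onPath i≤m | onPath k≤m | notPastPath i≤m | notPastPath k≤m | offRight (≤m⇒≤m+ℓ i≤m) | offRight (≤m⇒≤m+ℓ k≤m)
      with k ≡ᵇ suc i in k≡1+i | i ≡ᵇ suc k in i≡1+k
    ... | true  | true  =
      ⊥-elim (1+1+≢ i (trans (ℕₚ.≡ᵇ⇒≡ i (suc k) (from T-≡ i≡1+k)) (cong suc (ℕₚ.≡ᵇ⇒≡ k (suc i) (from T-≡ k≡1+i)))))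
    ... | true  | false = sym (ℚₚ.+-identityʳ _)
    ... | false | true  = sym (ℚₚ.+-identityˡ _)
    ... | false | false = refl

    adj-path-left : ∀ i j (H : ℕ → ℚ) → i ≤ m → m < j → j ≤ m ℕ.+ ℓ →
      (if adj i j then H j else 0ℚ) ≡ (if i ≡ᵇ 0 then H j else 0ℚ)
    adj-path-left i j H i≤m m<j j≤m+ℓ
      rewrite onPath i≤m | notPastPath i≤m | offRight (≤m⇒≤m+ℓ i≤m) | offPath m<j | pastPath m<j | beforeRight j≤m+ℓ | offRight j≤m+ℓ
      with i ≡ᵇ 0
    ... | true  = refl
    ... | false = refl

    adj-path-right : ∀ i j (H : ℕ → ℚ) → i ≤ m → m ℕ.+ ℓ < j →
      (if adj i j then H j else 0ℚ) ≡ (if i ≡ᵇ m then H j else 0ℚ)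
    adj-path-right i j H i≤m m+ℓ<j
      rewrite onPath i≤m | notPastPath i≤m | offRight (≤m⇒≤m+ℓ i≤m) | offPath (>m+ℓ⇒>m m+ℓ<j) | pastPath (>m+ℓ⇒>m m+ℓ<j)
            | notBeforeRight m+ℓ<j | onRight m+ℓ<j
      with i ≡ᵇ m
    ... | true  = refl
    ... | false = refl

    adj-left-path : ∀ i k (H : ℕ → ℚ) → m < i → i ≤ m ℕ.+ ℓ → k ≤ m →
      (if adj i k then H k else 0ℚ) ≡ (if k ≡ᵇ 0 then H k else 0ℚ)
    adj-left-path i k H m<i i≤m+ℓ k≤m
      rewrite onPath k≤m | notPastPath k≤m | offRight (≤m⇒≤m+ℓ k≤m) | offPath m<i | pastPath m<i | beforeRight i≤m+ℓ | offRight i≤m+ℓ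
      with k ≡ᵇ 0
    ... | true  = refl
    ... | false = refl

    adj-right-path : ∀ i k (H : ℕ → ℚ) → m ℕ.+ ℓ < i → k ≤ m →
      (if adj i k then H k else 0ℚ) ≡ (if k ≡ᵇ m then H k else 0ℚ)
    adj-right-path i k H m+ℓ<i k≤m
      rewrite onPath k≤m | notPastPath k≤m | offRight (≤m⇒≤m+ℓ k≤m) | offPath (>m+ℓ⇒>m m+ℓ<i) | pastPath (>m+ℓ⇒>m m+ℓ<i)
            | notBeforeRight m+ℓ<i | onRight m+ℓ<i
      with k ≡ᵇ m
    ... | true  = refl
    ... | false = refl

    private
      edgeDir-from-leaf : ∀ i j → m < i → edgeDir (suc (suc m)) ℓ r i j ≡ false
      edgeDir-from-leaf i j m<i rewrite offPath m<i | notFirst m<i | notLast m<i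
        with isLeftV (suc (suc m)) ℓ r j | isRightV (suc (suc m)) ℓ r j
      ... | toLeft | toRight = cong₂ _∨_ (∧-zeroʳ toLeft) (∧-zeroʳ toRight)

    adj-leaf-leaf : ∀ i j (H : ℕ → ℚ) → m < i → m < j → (if adj i j then H j else 0ℚ) ≡ 0ℚ
    adj-leaf-leaf i j H m<i m<j rewrite edgeDir-from-leaf i j m<i | edgeDir-from-leaf j i m<j = refl

    next : (ℕ → ℚ) → ℕ → ℚ
    next H i = if i ≡ᵇ m then 0ℚ else H (suc i)

    prev : (ℕ → ℚ) → ℕ → ℚ
    prev H zero    = 0ℚ
    prev H (suc i) = H i

    sumBelow-next : ∀ H i → i ≤ m → sumBelow (suc m) (λ k → if k ≡ᵇ suc i then H k else 0ℚ) ≡ next H i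
    sumBelow-next H i i≤m with i ℕ.≟ m
    ... | yes refl rewrite ≡ᵇ-refl i = sumBelow-δ-outside (suc m) (suc m) H ℕₚ.≤-refl
    ... | no i≢m   rewrite ≡ᵇ-false i≢m = sumBelow-δ (suc m) (suc i) H (s≤s (ℕₚ.≤∧≢⇒< i≤m i≢m))

    sumBelow-prev : ∀ H i → i ≤ m → sumBelow (suc m) (λ k → if i ≡ᵇ suc k then H k else 0ℚ) ≡ prev H i
    sumBelow-prev H zero    _     = sumBelow-zero (suc m)
    sumBelow-prev H (suc i) i<m =
      trans (sumBelow-cong (suc m) (λ k _ → cong (λ b → if b then H k else 0ℚ) (≡ᵇ-comm i k)))
            (sumBelow-δ (suc m) i H (s≤s (ℕₚ.<⇒≤ i<m)))

    nbrSum-path : ∀ H i → i ≤ m → nbrSum H i ≡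
      ((next H i + prev H i) + (if i ≡ᵇ 0 then leftSum H else 0ℚ)) + (if i ≡ᵇ m then rightSum H else 0ℚ)
    nbrSum-path H i i≤m = trans (sumBelow-size (λ j → if adj i j then H j else 0ℚ)) (cong₂ _+_ (cong₂ _+_ on-path on-left) on-right)
      where
      open ≡-Reasoning
      on-path : sumBelow (suc m) (λ k → if adj i k then H k else 0ℚ) ≡ next H i + prev H i
      on-path = begin
        sumBelow (suc m) (λ k → if adj i k then H k else 0ℚ)
          ≡⟨ sumBelow-cong (suc m) (λ k k<1+m → adj-path-path i k H i≤m (ℕₚ.≤-pred k<1+m)) ⟩
        sumBelow (suc m) (λ k → (if k ≡ᵇ suc i then H k else 0ℚ) + (if i ≡ᵇ suc k then H k else 0ℚ))
          ≡⟨ sumBelow-distrib (suc m) (λ k → if k ≡ᵇ suc i then H k else 0ℚ) (λ k → if i ≡ᵇ suc k then H k else 0ℚ) ⟩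
        sumBelow (suc m) (λ k → if k ≡ᵇ suc i then H k else 0ℚ) + sumBelow (suc m) (λ k → if i ≡ᵇ suc k then H k else 0ℚ)
          ≡⟨ cong₂ _+_ (sumBelow-next H i i≤m) (sumBelow-prev H i i≤m) ⟩
        next H i + prev H i ∎
      on-left : sumBelow ℓ (λ a → if adj i (suc m ℕ.+ a) then H (suc m ℕ.+ a) else 0ℚ) ≡ (if i ≡ᵇ 0 then leftSum H else 0ℚ)
      on-left = trans (sumBelow-cong ℓ (λ a a<ℓ → adj-path-left i _ H i≤m (left-above a) (left-below a<ℓ)))
                      (sumBelow-if ℓ (i ≡ᵇ 0) _)
      on-right : sumBelow r (λ a → if adj i (suc m ℕ.+ ℓ ℕ.+ a) then H (suc m ℕ.+ ℓ ℕ.+ a) else 0ℚ) ≡ (if i ≡ᵇ m then rightSum H else 0ℚ)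
      on-right = trans (sumBelow-cong r (λ a _ → adj-path-right i _ H i≤m (right-above a)))
                       (sumBelow-if r (i ≡ᵇ m) _)

    private
      nbrSum-leaf : ∀ H i k → m < i → k ≤ m →
        (∀ j → j ≤ m → (if adj i j then H j else 0ℚ) ≡ (if j ≡ᵇ k then H j else 0ℚ)) → nbrSum H i ≡ H k
      nbrSum-leaf H i k m<i k≤m adj-path =
        trans (sumBelow-size (λ j → if adj i j then H j else 0ℚ))
              (trans (cong₂ _+_ (cong₂ _+_ on-path on-left) on-right)
                     (trans (ℚₚ.+-identityʳ (H k + 0ℚ)) (ℚₚ.+-identityʳ (H k))))
        where
        on-path : sumBelow (suc m) (λ j → if adj i j then H j else 0ℚ) ≡ H k
        on-path = trans (sumBelow-cong (suc m) (λ j j<1+m → adj-path j (ℕₚ.≤-pred j<1+m))) (sumBelow-δ (suc m) k H (s≤s k≤m))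
        on-left : sumBelow ℓ (λ a → if adj i (suc m ℕ.+ a) then H (suc m ℕ.+ a) else 0ℚ) ≡ 0ℚ
        on-left = trans (sumBelow-cong ℓ (λ a _ → adj-leaf-leaf i _ H m<i (left-above a))) (sumBelow-zero ℓ)
        on-right : sumBelow r (λ a → if adj i (suc m ℕ.+ ℓ ℕ.+ a) then H (suc m ℕ.+ ℓ ℕ.+ a) else 0ℚ) ≡ 0ℚ
        on-right = trans (sumBelow-cong r (λ a _ → adj-leaf-leaf i _ H m<i (>m+ℓ⇒>m (right-above a)))) (sumBelow-zero r)

    nbrSum-left : ∀ H i → m < i → i ≤ m ℕ.+ ℓ → nbrSum H i ≡ H 0
    nbrSum-left H i m<i i≤m+ℓ = nbrSum-leaf H i 0 m<i z≤n (λ j j≤m → adj-left-path i j H m<i i≤m+ℓ j≤m)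

    nbrSum-right : ∀ H i → m ℕ.+ ℓ < i → nbrSum H i ≡ H m
    nbrSum-right H i m+ℓ<i = nbrSum-leaf H i m (>m+ℓ⇒>m m+ℓ<i) ℕₚ.≤-refl (λ j j≤m → adj-right-path i j H m+ℓ<i j≤m)

  nbrSum-centre : ∀ H → nbrSum 0 H 0 ≡ leftSum 0 H + rightSum 0 H
  nbrSum-centre H = trans (nbrSum-path 0 H 0 z≤n) (0+0+x+y≡x+y (leftSum 0 H) (rightSum 0 H))
    where
    0+0+x+y≡x+y : ∀ x y → ((0ℚ + 0ℚ) + x) + y ≡ x + y
    0+0+x+y≡x+y = RingSolver.solve-∀ ℚ-ring

  nbrSum-first : ∀ m H → nbrSum (suc m) H 0 ≡ H 1 + leftSum (suc m) H
  nbrSum-first m H = trans (nbrSum-path (suc m) H 0 z≤n) (x+0+y+0≡x+y (H 1) (leftSum (suc m) H))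
    where
    x+0+y+0≡x+y : ∀ x y → ((x + 0ℚ) + y) + 0ℚ ≡ x + y
    x+0+y+0≡x+y = RingSolver.solve-∀ ℚ-ring

  nbrSum-inner : ∀ m H i → i < m → nbrSum (suc m) H (suc i) ≡ H (suc (suc i)) + H i
  nbrSum-inner m H i i<m = begin
    nbrSum (suc m) H (suc i)
      ≡⟨ nbrSum-path (suc m) H (suc i) (s≤s (ℕₚ.<⇒≤ i<m)) ⟩
    (((if i ≡ᵇ m then 0ℚ else H (suc (suc i))) + H i) + 0ℚ) + (if i ≡ᵇ m then rightSum (suc m) H else 0ℚ)
      ≡⟨ cong (λ b → (((if b then 0ℚ else H (suc (suc i))) + H i) + 0ℚ) + (if b then rightSum (suc m) H else 0ℚ))
              (≡ᵇ-false (ℕₚ.<⇒≢ i<m)) ⟩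
    ((H (suc (suc i)) + H i) + 0ℚ) + 0ℚ
      ≡⟨ trans (ℚₚ.+-identityʳ _) (ℚₚ.+-identityʳ _) ⟩
    H (suc (suc i)) + H i ∎
    where open ≡-Reasoning

  nbrSum-last : ∀ m H → nbrSum (suc m) H (suc m) ≡ H m + rightSum (suc m) H
  nbrSum-last m H = begin
    nbrSum (suc m) H (suc m)
      ≡⟨ nbrSum-path (suc m) H (suc m) ℕₚ.≤-refl ⟩
    (((if m ≡ᵇ m then 0ℚ else H (suc (suc m))) + H m) + 0ℚ) + (if m ≡ᵇ m then rightSum (suc m) H else 0ℚ)
      ≡⟨ cong (λ b → (((if b then 0ℚ else H (suc (suc m))) + H m) + 0ℚ) + (if b then rightSum (suc m) H else 0ℚ))
              (≡ᵇ-refl m) ⟩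
    ((0ℚ + H m) + 0ℚ) + rightSum (suc m) H
      ≡⟨ 0+x+0+y≡x+y (H m) (rightSum (suc m) H) ⟩
    H m + rightSum (suc m) H ∎
    where
    open ≡-Reasoning
    0+x+0+y≡x+y : ∀ x y → ((0ℚ + x) + 0ℚ) + y ≡ x + y
    0+x+0+y≡x+y = RingSolver.solve-∀ ℚ-ring

module Hitting (ℓ r′ : ℕ) where

  r : ℕ
  r = suc r′

  open Neighbourhood ℓ r public

  L R′ : ℚ
  L  = ℕtoℚ ℓ
  R′ = ℕtoℚ r′

  degree : ℕ → ℕ → ℚ
  degree m = nbrSum m (λ _ → 1ℚ)

  leftSum-one : ∀ m → leftSum m (λ _ → 1ℚ) ≡ L
  leftSum-one m = trans (sumBelow-const ℓ 1ℚ) (ℚₚ.*-identityʳ L)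

  rightSum-one : ∀ m → rightSum m (λ _ → 1ℚ) ≡ 1ℚ + R′
  rightSum-one m = trans (sumBelow-const r 1ℚ) (trans (ℚₚ.*-identityʳ (ℕtoℚ r)) (ℕtoℚ-suc r′))

  degree-centre : degree 0 0 ≡ L + (1ℚ + R′)
  degree-centre = trans (nbrSum-centre (λ _ → 1ℚ)) (cong₂ _+_ (leftSum-one 0) (rightSum-one 0))

  degree-first : ∀ m → degree (suc m) 0 ≡ 1ℚ + L
  degree-first m = trans (nbrSum-first m (λ _ → 1ℚ)) (cong (1ℚ +_) (leftSum-one (suc m)))

  degree-inner : ∀ m i → i < m → degree (suc m) (suc i) ≡ 1ℚ + 1ℚ
  degree-inner m i = nbrSum-inner m (λ _ → 1ℚ) i

  degree-last : ∀ m → degree (suc m) (suc m) ≡ 1ℚ + (1ℚ + R′)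
  degree-last m = trans (nbrSum-last m (λ _ → 1ℚ)) (cong (1ℚ +_) (rightSum-one (suc m)))

  degree≢0 : ∀ m i → degree m i ≢ 0ℚ
  degree≢0 m i with position m i
  ... | left m<i i≤m+ℓ = subst (_≢ 0ℚ) (sym (nbrSum-left m (λ _ → 1ℚ) i m<i i≤m+ℓ)) (ℕtoℚ-suc≢0 0)
  ... | right m+ℓ<i    = subst (_≢ 0ℚ) (sym (nbrSum-right m (λ _ → 1ℚ) i m+ℓ<i)) (ℕtoℚ-suc≢0 0)
  ... | path i≤m with pathVertex i≤m
  ...   | centre            = subst (_≢ 0ℚ) (sym degree-centre)
                                (subst (_≢ 0ℚ) (trans (ℕtoℚ-+ ℓ r) (cong (L +_) (ℕtoℚ-suc r′)))
                                  (subst (λ k → ℕtoℚ k ≢ 0ℚ) (sym (ℕₚ.+-suc ℓ r′)) (ℕtoℚ-suc≢0 (ℓ ℕ.+ r′))))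
  ...   | first {k}         = subst (_≢ 0ℚ) (sym (trans (degree-first k) (sym (ℕtoℚ-suc ℓ)))) (ℕtoℚ-suc≢0 ℓ)
  ...   | inner {k} {j} j<k = subst (_≢ 0ℚ) (sym (degree-inner k j j<k)) (ℕtoℚ-suc≢0 1)
  ...   | last {k}          = subst (_≢ 0ℚ) (sym (trans (degree-last k) (cong (1ℚ +_) (sym (ℕtoℚ-suc r′)))))
                                (subst (_≢ 0ℚ) (ℕtoℚ-suc r) (ℕtoℚ-suc≢0 r))

  Balanced : ℕ → (ℕ → ℚ) → ℕ → Set
  Balanced m H i = H i * degree m i ≡ degree m i + nbrSum m H i

  Balanced⇔ : ∀ {m H i D N a b} → degree m i ≡ D → nbrSum m H i ≡ N → a - b ≡ H i * D - (D + N) →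
    Balanced m H i ⇔ (a ≡ b)
  Balanced⇔ refl refl a-b≡ = ≡-difference⇔ (sym a-b≡)

  private
    x-y≡x*1-y : ∀ x y → x - y ≡ x * 1ℚ - y
    x-y≡x*1-y = RingSolver.solve-∀ ℚ-ring

  balanced-left⇔ : ∀ m H i → m < i → i ≤ m ℕ.+ ℓ → Balanced m H i ⇔ (H i ≡ 1ℚ + H 0)
  balanced-left⇔ m H i m<i i≤m+ℓ =
    Balanced⇔ {m} {H} {i} (nbrSum-left m (λ _ → 1ℚ) i m<i i≤m+ℓ) (nbrSum-left m H i m<i i≤m+ℓ)
      (x-y≡x*1-y (H i) (1ℚ + H 0))

  balanced-right⇔ : ∀ m H i → m ℕ.+ ℓ < i → Balanced m H i ⇔ (H i ≡ 1ℚ + H m)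
  balanced-right⇔ m H i m+ℓ<i =
    Balanced⇔ {m} {H} {i} (nbrSum-right m (λ _ → 1ℚ) i m+ℓ<i) (nbrSum-right m H i m+ℓ<i) (x-y≡x*1-y (H i) (1ℚ + H m))

  record HittingEquations (m t′ : ℕ) (H : ℕ → ℚ) : Set where
    field
      at-target : H (target m t′) ≡ 0ℚ
      balanced  : ∀ i → i < size m → i ≢ target m t′ → Balanced m H i

  -- With path index i standing for v_{i+1}: step i = H(v_{i+1}) − H(v_{i+2}) is twice the number
  -- ℓ + i of edges behind v_{i+1}, plus one, and lastValue m = H(v_{d−1}) = 2|E| − 1.
  step : ℚ → ℚ
  step x = ℕtoℚ 2 * L + ℕtoℚ 2 * x + 1ℚ

  lastValue : ℚ → ℚ
  lastValue M = ℕtoℚ 2 * L + ℕtoℚ 2 * M + ℕtoℚ 2 * R′ + 1ℚ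

  pathValue : ℚ → ℚ → ℚ
  pathValue M x = lastValue M + ℕtoℚ 2 * L * (M - x) + (M * M - x * x)

  record PathRecurrence (m : ℕ) (H : ℕ → ℚ) : Set where
    field
      descent : ∀ i → i < m → H i ≡ H (suc i) + step (ℕtoℚ i)
      end     : H m ≡ lastValue (ℕtoℚ m)

  centre⇔ : ∀ H → leftSum 0 H ≡ L * (1ℚ + H 0) → rightSum 0 H ≡ R′ * (1ℚ + H 0) →
    Balanced 0 H 0 ⇔ (H 0 ≡ lastValue 0ℚ)
  centre⇔ H left≡ right≡ =
    Balanced⇔ {0} {H} {0} degree-centre (trans (nbrSum-centre H) (cong₂ _+_ left≡ right≡)) (identity (H 0) L R′)
    where
    identity : ∀ h l ρ →
      h - (ℕtoℚ 2 * l + ℕtoℚ 2 * 0ℚ + ℕtoℚ 2 * ρ + 1ℚ)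
      ≡ h * (l + (1ℚ + ρ)) - ((l + (1ℚ + ρ)) + (l * (1ℚ + h) + ρ * (1ℚ + h)))
    identity = RingSolver.solve-∀ ℚ-ring

  first⇔ : ∀ m H → leftSum (suc m) H ≡ L * (1ℚ + H 0) → Balanced (suc m) H 0 ⇔ (H 0 ≡ H 1 + step 0ℚ)
  first⇔ m H left≡ =
    Balanced⇔ {suc m} {H} {0} (degree-first m) (trans (nbrSum-first m H) (cong (H 1 +_) left≡)) (identity (H 0) (H 1) L)
    where
    identity : ∀ h₀ h₁ l →
      h₀ - (h₁ + (ℕtoℚ 2 * l + ℕtoℚ 2 * 0ℚ + 1ℚ))
      ≡ h₀ * (1ℚ + l) - ((1ℚ + l) + (h₁ + l * (1ℚ + h₀)))
    identity = RingSolver.solve-∀ ℚ-ring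

  inner⇔ : ∀ m H i → i < m → H i ≡ H (suc i) + step (ℕtoℚ i) →
    Balanced (suc m) H (suc i) ⇔ (H (suc i) ≡ H (suc (suc i)) + step (ℕtoℚ (suc i)))
  inner⇔ m H i i<m descent-i =
    Balanced⇔ {suc m} {H} {suc i} (degree-inner m i i<m) (trans (nbrSum-inner m H i i<m) (cong (H (suc (suc i)) +_) descent-i))
      (trans (cong (λ x → H (suc i) - (H (suc (suc i)) + step x)) (ℕtoℚ-suc i))
             (identity (H (suc i)) (H (suc (suc i))) L (ℕtoℚ i)))
    where
    identity : ∀ h₁ h₂ l x →
      h₁ - (h₂ + (ℕtoℚ 2 * l + ℕtoℚ 2 * (1ℚ + x) + 1ℚ))
      ≡ h₁ * (1ℚ + 1ℚ) - ((1ℚ + 1ℚ) + (h₂ + (h₁ + (ℕtoℚ 2 * l + ℕtoℚ 2 * x + 1ℚ))))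
    identity = RingSolver.solve-∀ ℚ-ring

  last⇔ : ∀ m H → rightSum (suc m) H ≡ R′ * (1ℚ + H (suc m)) → H m ≡ H (suc m) + step (ℕtoℚ m) →
    Balanced (suc m) H (suc m) ⇔ (H (suc m) ≡ lastValue (ℕtoℚ (suc m)))
  last⇔ m H right≡ descent-m =
    Balanced⇔ {suc m} {H} {suc m} (degree-last m)
      (trans (nbrSum-last m H) (cong₂ _+_ descent-m right≡))
      (trans (cong (λ x → H (suc m) - lastValue x) (ℕtoℚ-suc m))
             (identity (H (suc m)) L R′ (ℕtoℚ m)))
    where
    identity : ∀ h l ρ M →
      h - (ℕtoℚ 2 * l + ℕtoℚ 2 * (1ℚ + M) + ℕtoℚ 2 * ρ + 1ℚ)
      ≡ h * (1ℚ + (1ℚ + ρ)) - ((1ℚ + (1ℚ + ρ)) + ((h + (ℕtoℚ 2 * l + ℕtoℚ 2 * M + 1ℚ)) + ρ * (1ℚ + h)))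
    identity = RingSolver.solve-∀ ℚ-ring

  balanced⇒recurrence : ∀ m H → leftSum m H ≡ L * (1ℚ + H 0) → rightSum m H ≡ R′ * (1ℚ + H m) →
    (∀ i → i ≤ m → Balanced m H i) → PathRecurrence m H
  balanced⇒recurrence zero H left≡ right≡ balanced =
    record { descent = λ _ () ; end = to (centre⇔ H left≡ right≡) (balanced 0 z≤n) }
  balanced⇒recurrence (suc m) H left≡ right≡ balanced =
    record { descent = descent ; end = to (last⇔ m H right≡ (descent m ℕₚ.≤-refl)) (balanced (suc m) ℕₚ.≤-refl) }
    where
    descent : ∀ i → i < suc m → H i ≡ H (suc i) + step (ℕtoℚ i)
    descent zero    _         = to (first⇔ m H left≡) (balanced 0 z≤n)
    descent (suc i) (s≤s i<m) =
      to (inner⇔ m H i i<m (descent i (ℕₚ.m<n⇒m<1+n i<m))) (balanced (suc i) (s≤s (ℕₚ.<⇒≤ i<m)))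

  recurrence⇒balanced : ∀ m H → leftSum m H ≡ L * (1ℚ + H 0) → rightSum m H ≡ R′ * (1ℚ + H m) →
    PathRecurrence m H → ∀ i → i ≤ m → Balanced m H i
  recurrence⇒balanced m H left≡ right≡ rec i i≤m with pathVertex i≤m
  ... | centre           = from (centre⇔ H left≡ right≡) (PathRecurrence.end rec)
  ... | first {k}        = from (first⇔ k H left≡) (PathRecurrence.descent rec 0 (s≤s z≤n))
  ... | inner {k} {j} j<k = from (inner⇔ k H j j<k (PathRecurrence.descent rec j (ℕₚ.m<n⇒m<1+n j<k)))
                                (PathRecurrence.descent rec (suc j) (s≤s j<k))
  ... | last {k}         = from (last⇔ k H right≡ (PathRecurrence.descent rec k ℕₚ.≤-refl)) (PathRecurrence.end rec)

  pathValue-step : ∀ M x → pathValue M x ≡ pathValue M (1ℚ + x) + step x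
  pathValue-step M x = identity (lastValue M) L M x
    where
    identity : ∀ A l M x →
      A + ℕtoℚ 2 * l * (M - x) + (M * M - x * x)
      ≡ (A + ℕtoℚ 2 * l * (M - (1ℚ + x)) + (M * M - (1ℚ + x) * (1ℚ + x))) + (ℕtoℚ 2 * l + ℕtoℚ 2 * x + 1ℚ)
    identity = RingSolver.solve-∀ ℚ-ring

  pathValue-end : ∀ M → pathValue M M ≡ lastValue M
  pathValue-end M = identity (lastValue M) L M
    where
    identity : ∀ A l M → (A + ℕtoℚ 2 * l * (M - M) + (M * M - M * M)) ≡ A
    identity = RingSolver.solve-∀ ℚ-ring

  recurrence-of-values : ∀ m {H} → (∀ i → i ≤ m → H i ≡ pathValue (ℕtoℚ m) (ℕtoℚ i)) → PathRecurrence m H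
  recurrence-of-values m {H} H≡ = record
    { descent = λ i i<m → begin
        H i                                                  ≡⟨ H≡ i (ℕₚ.<⇒≤ i<m) ⟩
        pathValue (ℕtoℚ m) (ℕtoℚ i)                          ≡⟨ pathValue-step (ℕtoℚ m) (ℕtoℚ i) ⟩
        pathValue (ℕtoℚ m) (1ℚ + ℕtoℚ i) + step (ℕtoℚ i)     ≡⟨ cong (λ x → pathValue (ℕtoℚ m) x + step (ℕtoℚ i)) (ℕtoℚ-suc i) ⟨
        pathValue (ℕtoℚ m) (ℕtoℚ (suc i)) + step (ℕtoℚ i)    ≡⟨ cong (_+ step (ℕtoℚ i)) (H≡ (suc i) i<m) ⟨
        H (suc i) + step (ℕtoℚ i)                            ∎
    ; end = trans (H≡ m ℕₚ.≤-refl) (pathValue-end (ℕtoℚ m))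
    }
    where open ≡-Reasoning

  PathRecurrence⇔ : ∀ {m H} → PathRecurrence m H ⇔ (∀ i → i ≤ m → H i ≡ pathValue (ℕtoℚ m) (ℕtoℚ i))
  PathRecurrence⇔ {m} {H} = mk⇔ solve (recurrence-of-values m)
    where
    solve : PathRecurrence m H → ∀ i → i ≤ m → H i ≡ pathValue (ℕtoℚ m) (ℕtoℚ i)
    solve rec = backward-recurrence-unique m H (λ i → pathValue (ℕtoℚ m) (ℕtoℚ i)) (λ i → step (ℕtoℚ i))
      (PathRecurrence.descent rec) (PathRecurrence.descent (recurrence-of-values m (λ _ _ → refl)))
      (trans (PathRecurrence.end rec) (sym (pathValue-end (ℕtoℚ m))))

  record ExplicitForm (m t′ : ℕ) (H : ℕ → ℚ) : Set where
    field
      at-target  : H (target m t′) ≡ 0ℚ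
      left-leaf  : ∀ i → m < i → i ≤ m ℕ.+ ℓ → H i ≡ 1ℚ + H 0
      right-leaf : ∀ i → m ℕ.+ ℓ < i → i < size m → i ≢ target m t′ → H i ≡ 1ℚ + H m
      on-path    : ∀ i → i ≤ m → H i ≡ pathValue (ℕtoℚ m) (ℕtoℚ i)

  leftSum-leaves : ∀ m {H} → (∀ i → m < i → i ≤ m ℕ.+ ℓ → H i ≡ 1ℚ + H 0) → leftSum m H ≡ L * (1ℚ + H 0)
  leftSum-leaves m left-leaf =
    trans (sumBelow-cong ℓ (λ a a<ℓ → left-leaf _ (left-above m a) (left-below m a<ℓ))) (sumBelow-const ℓ _)

  rightSum-leaves : ∀ m {t′ H} → t′ < r →
    (∀ i → m ℕ.+ ℓ < i → i < size m → i ≢ target m t′ → H i ≡ 1ℚ + H m) → H (target m t′) ≡ 0ℚ →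
    rightSum m H ≡ R′ * (1ℚ + H m)
  rightSum-leaves m {t′} t′<r right-leaf at-target = sumBelow-except-one r′ t′ _ t′<r
    (λ a a<r a≢t′ → right-leaf _ (right-above m a) (right<size m a<r) (right-leaf≢target m a≢t′)) at-target

  HittingEquations⇔ExplicitForm : ∀ {m t′ H} → t′ < r → HittingEquations m t′ H ⇔ ExplicitForm m t′ H
  HittingEquations⇔ExplicitForm {m} {t′} {H} t′<r = mk⇔ explicit equations
    where
    explicit : HittingEquations m t′ H → ExplicitForm m t′ H
    explicit E = record
      { at-target  = at-target
      ; left-leaf  = left-leaf
      ; right-leaf = right-leaf
      ; on-path    = to PathRecurrence⇔ (balanced⇒recurrence m H
          (leftSum-leaves m left-leaf) (rightSum-leaves m t′<r right-leaf at-target)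
          (λ i i≤m → let i≤m+ℓ = ℕₚ.≤-trans i≤m (ℕₚ.m≤m+n m ℓ) in
                     balanced i (≤m+ℓ⇒<size m i≤m+ℓ) (≤m+ℓ⇒≢target m t′ i≤m+ℓ)))
      }
      where
      open HittingEquations E
      left-leaf : ∀ i → m < i → i ≤ m ℕ.+ ℓ → H i ≡ 1ℚ + H 0
      left-leaf i m<i i≤m+ℓ = to (balanced-left⇔ m H i m<i i≤m+ℓ)
        (balanced i (≤m+ℓ⇒<size m i≤m+ℓ) (≤m+ℓ⇒≢target m t′ i≤m+ℓ))
      right-leaf : ∀ i → m ℕ.+ ℓ < i → i < size m → i ≢ target m t′ → H i ≡ 1ℚ + H m
      right-leaf i m+ℓ<i i<n i≢t = to (balanced-right⇔ m H i m+ℓ<i) (balanced i i<n i≢t)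
    equations : ExplicitForm m t′ H → HittingEquations m t′ H
    equations X = record { at-target = at-target ; balanced = balanced }
      where
      open ExplicitForm X
      balanced : ∀ i → i < size m → i ≢ target m t′ → Balanced m H i
      balanced i i<n i≢t with position m i
      ... | path i≤m       = recurrence⇒balanced m H (leftSum-leaves m left-leaf)
                               (rightSum-leaves m t′<r right-leaf at-target) (from PathRecurrence⇔ on-path) i i≤m
      ... | left m<i i≤m+ℓ = from (balanced-left⇔ m H i m<i i≤m+ℓ) (left-leaf i m<i i≤m+ℓ)
      ... | right m+ℓ<i    = from (balanced-right⇔ m H i m+ℓ<i) (right-leaf i m+ℓ<i i<n i≢t)

  candidate : ℕ → ℕ → ℕ → ℚ
  candidate m t j =
    if j <ᵇ suc m then pathValue M (ℕtoℚ j)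
    else if j <ᵇ suc (m ℕ.+ ℓ) then 1ℚ + pathValue M 0ℚ
    else if j ≡ᵇ t then 0ℚ
    else 1ℚ + pathValue M M
    where
    M = ℕtoℚ m

  candidate-path : ∀ m t j → j ≤ m → candidate m t j ≡ pathValue (ℕtoℚ m) (ℕtoℚ j)
  candidate-path m t j j≤m rewrite <ᵇ-true (s≤s j≤m) = refl

  candidate-left : ∀ m t j → m < j → j ≤ m ℕ.+ ℓ → candidate m t j ≡ 1ℚ + candidate m t 0
  candidate-left m t j m<j j≤m+ℓ rewrite <ᵇ-false {j} {suc m} m<j | <ᵇ-true (s≤s j≤m+ℓ) = refl

  candidate-right : ∀ m t j → m ℕ.+ ℓ < j → j ≢ t → candidate m t j ≡ 1ℚ + pathValue (ℕtoℚ m) (ℕtoℚ m)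
  candidate-right m t j m+ℓ<j j≢t
    rewrite <ᵇ-false {j} {suc m} (ℕₚ.≤-trans (s≤s (ℕₚ.m≤m+n m ℓ)) m+ℓ<j) | <ᵇ-false {j} {suc (m ℕ.+ ℓ)} m+ℓ<j
          | ≡ᵇ-false j≢t = refl

  candidate-target : ∀ m t → m ℕ.+ ℓ < t → candidate m t t ≡ 0ℚ
  candidate-target m t m+ℓ<t
    rewrite <ᵇ-false {t} {suc m} (ℕₚ.≤-trans (s≤s (ℕₚ.m≤m+n m ℓ)) m+ℓ<t) | <ᵇ-false {t} {suc (m ℕ.+ ℓ)} m+ℓ<t
          | ≡ᵇ-refl t = refl

  candidate-explicit : ∀ m t′ → ExplicitForm m t′ (candidate m (target m t′))
  candidate-explicit m t′ = record
    { at-target  = candidate-target m t (right-above m t′)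
    ; left-leaf  = candidate-left m t
    ; right-leaf = λ i m+ℓ<i _ i≢t →
        trans (candidate-right m t i m+ℓ<i i≢t) (cong (1ℚ +_) (sym (candidate-path m t m ℕₚ.≤-refl)))
    ; on-path    = candidate-path m t
    }
    where
    t = target m t′

  weighted-path : ∀ m (H : ℕ → ℚ) j → j ≤ m → degree m j * H j ≡
    (H j + H j) + ((if j ≡ᵇ 0 then (L - 1ℚ) * H j else 0ℚ) + (if j ≡ᵇ m then R′ * H j else 0ℚ))
  weighted-path m H j j≤m with pathVertex j≤m
  ... | centre = trans (cong (_* H 0) degree-centre) (identity L R′ (H 0))
    where
    identity : ∀ l ρ h → (l + (1ℚ + ρ)) * h ≡ (h + h) + ((l - 1ℚ) * h + ρ * h)
    identity = RingSolver.solve-∀ ℚ-ring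
  ... | first {k} = trans (cong (_* H 0) (degree-first k)) (identity L (H 0))
    where
    identity : ∀ l h → (1ℚ + l) * h ≡ (h + h) + ((l - 1ℚ) * h + 0ℚ)
    identity = RingSolver.solve-∀ ℚ-ring
  ... | inner {k} {i} i<k =
    trans (cong (_* H (suc i)) (degree-inner k i i<k))
          (trans (identity (H (suc i)))
                 (cong (λ b → (H (suc i) + H (suc i)) + (0ℚ + (if b then R′ * H (suc i) else 0ℚ)))
                       (sym (≡ᵇ-false (ℕₚ.<⇒≢ i<k)))))
    where
    identity : ∀ h → (1ℚ + 1ℚ) * h ≡ (h + h) + (0ℚ + 0ℚ)
    identity = RingSolver.solve-∀ ℚ-ring
  ... | last {k} =
    trans (cong (_* H (suc k)) (degree-last k))
          (trans (identity R′ (H (suc k)))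
                 (cong (λ b → (H (suc k) + H (suc k)) + (0ℚ + (if b then R′ * H (suc k) else 0ℚ)))
                       (sym (≡ᵇ-refl k))))
    where
    identity : ∀ ρ h → (1ℚ + (1ℚ + ρ)) * h ≡ (h + h) + (0ℚ + ρ * h)
    identity = RingSolver.solve-∀ ℚ-ring

  weightedDegreeSum : ∀ m H → sumBelow (size m) (λ j → degree m j * H j) ≡
    (((sumBelow (suc m) H + sumBelow (suc m) H) + ((L - 1ℚ) * H 0 + R′ * H m)) + leftSum m H) + rightSum m H
  weightedDegreeSum m H =
    trans (sumBelow-size m (λ j → degree m j * H j)) (cong₂ _+_ (cong₂ _+_ on-path on-left) on-right)
    where
    open ≡-Reasoning
    atFirst atLast : ℕ → ℚ
    atFirst j = if j ≡ᵇ 0 then (L - 1ℚ) * H j else 0ℚ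
    atLast j  = if j ≡ᵇ m then R′ * H j else 0ℚ
    on-path : sumBelow (suc m) (λ j → degree m j * H j) ≡
      (sumBelow (suc m) H + sumBelow (suc m) H) + ((L - 1ℚ) * H 0 + R′ * H m)
    on-path = begin
      sumBelow (suc m) (λ j → degree m j * H j)
        ≡⟨ sumBelow-cong (suc m) (λ j j<1+m → weighted-path m H j (ℕₚ.≤-pred j<1+m)) ⟩
      sumBelow (suc m) (λ j → (H j + H j) + (atFirst j + atLast j))
        ≡⟨ sumBelow-distrib (suc m) (λ j → H j + H j) (λ j → atFirst j + atLast j) ⟩
      sumBelow (suc m) (λ j → H j + H j) + sumBelow (suc m) (λ j → atFirst j + atLast j)
        ≡⟨ cong₂ _+_ (sumBelow-distrib (suc m) H H) (sumBelow-distrib (suc m) atFirst atLast) ⟩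
      (sumBelow (suc m) H + sumBelow (suc m) H) + (sumBelow (suc m) atFirst + sumBelow (suc m) atLast)
        ≡⟨ cong ((sumBelow (suc m) H + sumBelow (suc m) H) +_) (cong₂ _+_ (sumBelow-δ (suc m) 0 (λ j → (L - 1ℚ) * H j) (s≤s z≤n))
                                  (sumBelow-δ (suc m) m (λ j → R′ * H j) ℕₚ.≤-refl)) ⟩
      (sumBelow (suc m) H + sumBelow (suc m) H) + ((L - 1ℚ) * H 0 + R′ * H m) ∎
    on-left : sumBelow ℓ (λ a → degree m (suc m ℕ.+ a) * H (suc m ℕ.+ a)) ≡ leftSum m H
    on-left = sumBelow-cong ℓ (λ a a<ℓ →
      trans (cong (_* H (suc m ℕ.+ a)) (nbrSum-left m (λ _ → 1ℚ) _ (left-above m a) (left-below m a<ℓ)))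
            (ℚₚ.*-identityˡ _))
    on-right : sumBelow r (λ a → degree m (suc m ℕ.+ ℓ ℕ.+ a) * H (suc m ℕ.+ ℓ ℕ.+ a)) ≡ rightSum m H
    on-right = sumBelow-cong r {g′ = λ a → H (suc m ℕ.+ ℓ ℕ.+ a)} (λ a _ →
      trans (cong (_* H (suc m ℕ.+ ℓ ℕ.+ a)) (nbrSum-right m (λ _ → 1ℚ) _ (right-above m a)))
            (ℚₚ.*-identityˡ _))

  degreeSum : ∀ m → ℕtoℚ 3 * sumBelow (size m) (degree m) ≡ ℕtoℚ (6 ℕ.* (m ℕ.+ ℓ ℕ.+ r))
  degreeSum m = begin
    ℕtoℚ 3 * sumBelow (size m) (degree m)
      ≡⟨ cong (ℕtoℚ 3 *_) (trans (sumBelow-cong (size m) (λ j _ → sym (ℚₚ.*-identityʳ (degree m j))))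
                                  (weightedDegreeSum m (λ _ → 1ℚ))) ⟩
    ℕtoℚ 3 * ((((count + count) + ((L - 1ℚ) * 1ℚ + R′ * 1ℚ)) + leftSum m (λ _ → 1ℚ)) + rightSum m (λ _ → 1ℚ))
      ≡⟨ cong (ℕtoℚ 3 *_) (cong₂ _+_ (cong₂ _+_ (cong (_+ ((L - 1ℚ) * 1ℚ + R′ * 1ℚ)) (cong₂ _+_ count≡ count≡))
                                               (leftSum-one m))
                                    (rightSum-one m)) ⟩
    ℕtoℚ 3 * (((((1ℚ + M) * 1ℚ + (1ℚ + M) * 1ℚ) + ((L - 1ℚ) * 1ℚ + R′ * 1ℚ)) + L) + (1ℚ + R′))
      ≡⟨ identity M L R′ ⟩
    ℕtoℚ 6 * ((M + L) + (1ℚ + R′))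
      ≡⟨ trans (ℕtoℚ-* 6 (m ℕ.+ ℓ ℕ.+ r)) (cong (ℕtoℚ 6 *_) (trans (ℕtoℚ-+ (m ℕ.+ ℓ) r)
               (cong₂ _+_ (ℕtoℚ-+ m ℓ) (ℕtoℚ-suc r′)))) ⟨
    ℕtoℚ (6 ℕ.* (m ℕ.+ ℓ ℕ.+ r)) ∎
    where
    open ≡-Reasoning
    M = ℕtoℚ m
    count = sumBelow (suc m) (λ _ → 1ℚ)
    count≡ : count ≡ (1ℚ + M) * 1ℚ
    count≡ = trans (sumBelow-const (suc m) 1ℚ) (cong (_* 1ℚ) (ℕtoℚ-suc m))
    identity : ∀ M l ρ → ℕtoℚ 3 * (((((1ℚ + M) * 1ℚ + (1ℚ + M) * 1ℚ) + ((l - 1ℚ) * 1ℚ + ρ * 1ℚ)) + l) + (1ℚ + ρ))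
                         ≡ ℕtoℚ 6 * ((M + l) + (1ℚ + ρ))
    identity = RingSolver.solve-∀ ℚ-ring

  pathValueSum : ℚ → ℚ → ℚ
  pathValueSum M x = ℕtoℚ 6 * x * (lastValue M + ℕtoℚ 2 * L * M + M * M)
                     - (ℕtoℚ 6 * L * x * (x - 1ℚ) + (x - 1ℚ) * x * (ℕtoℚ 2 * x - 1ℚ))

  sumBelow-pathValue : ∀ M n → ℕtoℚ 6 * sumBelow n (λ j → pathValue M (ℕtoℚ j)) ≡ pathValueSum M (ℕtoℚ n)
  sumBelow-pathValue M zero    = base L R′ M
    where
    base : ∀ l ρ M →
      let c = (ℕtoℚ 2 * l + ℕtoℚ 2 * M + ℕtoℚ 2 * ρ + 1ℚ) + ℕtoℚ 2 * l * M + M * M in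
      ℕtoℚ 6 * 0ℚ ≡ ℕtoℚ 6 * 0ℚ * c - (ℕtoℚ 6 * l * 0ℚ * (0ℚ - 1ℚ) + (0ℚ - 1ℚ) * 0ℚ * (ℕtoℚ 2 * 0ℚ - 1ℚ))
    base = RingSolver.solve-∀ ℚ-ring
  sumBelow-pathValue M (suc n) = begin
    ℕtoℚ 6 * sumBelow (suc n) p
      ≡⟨ cong (ℕtoℚ 6 *_) (sumBelow-snoc n p) ⟩
    ℕtoℚ 6 * (sumBelow n p + p n)
      ≡⟨ ℚₚ.*-distribˡ-+ (ℕtoℚ 6) (sumBelow n p) (p n) ⟩
    ℕtoℚ 6 * sumBelow n p + ℕtoℚ 6 * p n
      ≡⟨ cong (_+ ℕtoℚ 6 * p n) (sumBelow-pathValue M n) ⟩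
    pathValueSum M (ℕtoℚ n) + ℕtoℚ 6 * pathValue M (ℕtoℚ n)
      ≡⟨ step-identity L R′ M (ℕtoℚ n) ⟩
    pathValueSum M (1ℚ + ℕtoℚ n)
      ≡⟨ cong (pathValueSum M) (ℕtoℚ-suc n) ⟨
    pathValueSum M (ℕtoℚ (suc n)) ∎
    where
    open ≡-Reasoning
    p = λ j → pathValue M (ℕtoℚ j)
    step-identity : ∀ l ρ M x →
      let A = ℕtoℚ 2 * l + ℕtoℚ 2 * M + ℕtoℚ 2 * ρ + 1ℚ
          c = A + ℕtoℚ 2 * l * M + M * M
          y = 1ℚ + x
      in (ℕtoℚ 6 * x * c - (ℕtoℚ 6 * l * x * (x - 1ℚ) + (x - 1ℚ) * x * (ℕtoℚ 2 * x - 1ℚ)))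
         + ℕtoℚ 6 * (A + ℕtoℚ 2 * l * (M - x) + (M * M - x * x))
         ≡ ℕtoℚ 6 * y * c - (ℕtoℚ 6 * l * y * (y - 1ℚ) + (y - 1ℚ) * y * (ℕtoℚ 2 * y - 1ℚ))
    step-identity = RingSolver.solve-∀ ℚ-ring

  weightedDegreeSum-explicit : ∀ {m t′ H} → t′ < r → ExplicitForm m t′ H →
    let M = ℕtoℚ m ; P = sumBelow (suc m) (λ j → pathValue M (ℕtoℚ j)) in
    sumBelow (size m) (λ j → degree m j * H j) ≡
    (((P + P) + ((L - 1ℚ) * pathValue M 0ℚ + R′ * pathValue M M)) + L * (1ℚ + pathValue M 0ℚ)) + R′ * (1ℚ + pathValue M M)
  weightedDegreeSum-explicit {m} {t′} {H} t′<r X = trans (weightedDegreeSum m H)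
    (cong₂ _+_
      (cong₂ _+_
        (cong₂ _+_ (cong₂ _+_ P≡ P≡) (cong₂ _+_ (cong ((L - 1ℚ) *_) H0≡) (cong (R′ *_) Hm≡)))
        (trans (leftSum-leaves m left-leaf) (cong (λ h → L * (1ℚ + h)) H0≡)))
      (trans (rightSum-leaves m t′<r right-leaf at-target) (cong (λ h → R′ * (1ℚ + h)) Hm≡)))
    where
    open ExplicitForm X
    P≡ : sumBelow (suc m) H ≡ sumBelow (suc m) (λ j → pathValue (ℕtoℚ m) (ℕtoℚ j))
    P≡ = sumBelow-cong (suc m) (λ j j<1+m → on-path j (ℕₚ.≤-pred j<1+m))
    H0≡ : H 0 ≡ pathValue (ℕtoℚ m) 0ℚ
    H0≡ = on-path 0 z≤n
    Hm≡ : H m ≡ pathValue (ℕtoℚ m) (ℕtoℚ m)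
    Hm≡ = on-path m ℕₚ.≤-refl

  explicit-weightedDegreeSum : ∀ {m t′ H} → t′ < r → ExplicitForm m t′ H →
    ℕtoℚ 3 * sumBelow (size m) (λ j → degree m j * H j) ≡ evalℚ broomNumeratorPoly (ℕtoℚ (suc (suc m))) L (ℕtoℚ r)
  explicit-weightedDegreeSum {m} {t′} {H} t′<r X = begin
    ℕtoℚ 3 * sumBelow (size m) (λ j → degree m j * H j)
      ≡⟨ cong (ℕtoℚ 3 *_) (weightedDegreeSum-explicit t′<r X) ⟩
    ℕtoℚ 3 * ((((P + P) + ((L - 1ℚ) * h₀ + R′ * hₘ)) + L * (1ℚ + h₀)) + R′ * (1ℚ + hₘ))
      ≡⟨ separate P L R′ h₀ hₘ ⟩
    ℕtoℚ 6 * P + rest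
      ≡⟨ cong (_+ rest) (trans (sumBelow-pathValue M (suc m)) (cong (pathValueSum M) (ℕtoℚ-suc m))) ⟩
    pathValueSum M (1ℚ + M) + rest
      ≡⟨ closed-form L R′ M ⟩
    evalℚ broomNumeratorPoly (1ℚ + (1ℚ + M)) L (1ℚ + R′)
      ≡⟨ cong₂ (λ d ρ → evalℚ broomNumeratorPoly d L ρ)
               (trans (ℕtoℚ-suc (suc m)) (cong (1ℚ +_) (ℕtoℚ-suc m))) (ℕtoℚ-suc r′) ⟨
    evalℚ broomNumeratorPoly (ℕtoℚ (suc (suc m))) L (ℕtoℚ r) ∎
    where
    open ≡-Reasoning
    M  = ℕtoℚ m
    P  = sumBelow (suc m) (λ j → pathValue M (ℕtoℚ j))
    h₀ = pathValue M 0ℚ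
    hₘ = pathValue M M
    rest = ℕtoℚ 3 * ((((L - 1ℚ) * h₀ + R′ * hₘ) + L * (1ℚ + h₀)) + R′ * (1ℚ + hₘ))
    separate : ∀ P l ρ h₀ hₘ →
      ℕtoℚ 3 * ((((P + P) + ((l - 1ℚ) * h₀ + ρ * hₘ)) + l * (1ℚ + h₀)) + ρ * (1ℚ + hₘ))
      ≡ ℕtoℚ 6 * P + ℕtoℚ 3 * ((((l - 1ℚ) * h₀ + ρ * hₘ) + l * (1ℚ + h₀)) + ρ * (1ℚ + hₘ))
    separate = RingSolver.solve-∀ ℚ-ring
    closed-form : ∀ l ρ M →
      let A  = ℕtoℚ 2 * l + ℕtoℚ 2 * M + ℕtoℚ 2 * ρ + 1ℚ
          h₀ = A + ℕtoℚ 2 * l * (M - 0ℚ) + (M * M - 0ℚ * 0ℚ)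
          hₘ = A + ℕtoℚ 2 * l * (M - M) + (M * M - M * M)
          x  = 1ℚ + M
          d  = 1ℚ + x
          e  = 1ℚ + ρ
      in ℕtoℚ 6 * x * (A + ℕtoℚ 2 * l * M + M * M) - (ℕtoℚ 6 * l * x * (x - 1ℚ) + (x - 1ℚ) * x * (ℕtoℚ 2 * x - 1ℚ))
         + ℕtoℚ 3 * ((((l - 1ℚ) * h₀ + ρ * hₘ) + l * (1ℚ + h₀)) + ρ * (1ℚ + hₘ))
         ≡ ℕtoℚ 4 * d * d * d + ℕtoℚ 12 * d * d * (l + - ℕtoℚ 1)
           + d * (ℕtoℚ 12 * l * (l + - ℕtoℚ 2) + ℕtoℚ 24 * e + - ℕtoℚ 13)
           + ℕtoℚ 3 * (- (ℕtoℚ 4 * l * l) + l * (ℕtoℚ 8 * e + - ℕtoℚ 3) + e * (ℕtoℚ 4 * e + - ℕtoℚ 19) + ℕtoℚ 14)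
    closed-form = RingSolver.solve-∀ ℚ-ring

  module _ (m : ℕ) where

    private
      G : Graph (size m)
      G = doubleBroom (suc (suc m)) ℓ r

    lift : (Fin (size m) → ℚ) → ℕ → ℚ
    lift h j with j ℕ.<? size m
    ... | yes j<n = h (Fin.fromℕ< j<n)
    ... | no _    = 0ℚ

    lift-toℕ : ∀ h w → h w ≡ lift h (toℕ w)
    lift-toℕ h w with toℕ w ℕ.<? size m
    ... | yes w<n = cong h (sym (Finₚ.fromℕ<-toℕ w w<n))
    ... | no w≮n  = ⊥-elim (w≮n (Finₚ.toℕ<n w))

    ℕtoℚ-deg : ∀ u → ℕtoℚ (deg G u) ≡ degree m (toℕ u)
    ℕtoℚ-deg u = trans (ℕtoℚ-sumℕ (λ w → if G u w then 1 else 0))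
      (sumℚ≡sumBelow _ (λ j → if adj m (toℕ u) j then 1ℚ else 0ℚ) (λ w → ℕtoℚ-if (G u w)))
      where
      ℕtoℚ-if : ∀ b → ℕtoℚ (if b then 1 else 0) ≡ (if b then 1ℚ else 0ℚ)
      ℕtoℚ-if true  = refl
      ℕtoℚ-if false = refl

    first-step⇔Balanced : ∀ {h : Fin (size m) → ℚ} {H : ℕ → ℚ} → (∀ w → h w ≡ H (toℕ w)) → ∀ u →
      (h u ≡ 1ℚ + divℕ (sumℚ (λ w → if G u w then h w else 0ℚ)) (deg G u)) ⇔ Balanced m H (toℕ u)
    first-step⇔Balanced {h} {H} h≗H u =
      ⇔-trans (first-step⇔ (h u) S (deg G u) deg≢0) (transport (h≗H u) (ℕtoℚ-deg u) S≡nbrSum)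
      where
      S = sumℚ (λ w → if G u w then h w else 0ℚ)
      S≡nbrSum : S ≡ nbrSum m H (toℕ u)
      S≡nbrSum = sumℚ≡sumBelow _ (λ j → if adj m (toℕ u) j then H j else 0ℚ)
        (λ w → cong (λ x → if G u w then x else 0ℚ) (h≗H w))
      deg≢0 : ℕtoℚ (deg G u) ≢ 0ℚ
      deg≢0 = subst (_≢ 0ℚ) (sym (ℕtoℚ-deg u)) (degree≢0 m (toℕ u))
      transport : ∀ {x X k D s N} → x ≡ X → k ≡ D → s ≡ N → (x * k ≡ k + s) ⇔ (X * D ≡ D + N)
      transport refl refl refl = mk⇔ id id

    IsHittingTimeTo⇔HittingEquations : ∀ {h : Fin (size m) → ℚ} {H : ℕ → ℚ} {vd t′} →
      (∀ w → h w ≡ H (toℕ w)) → toℕ vd ≡ target m t′ →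
      IsHittingTimeTo G vd h ⇔ HittingEquations m t′ H
    IsHittingTimeTo⇔HittingEquations {h} {H} {vd} {t′} h≗H vd≡t = mk⇔ equations hitting-time
      where
      equations : IsHittingTimeTo G vd h → HittingEquations m t′ H
      equations (hvd≡0 , step) = record
        { at-target = trans (cong H (sym vd≡t)) (trans (sym (h≗H vd)) hvd≡0)
        ; balanced  = λ i i<n i≢t →
            let u≡i = Finₚ.toℕ-fromℕ< i<n in
            subst (Balanced m H) u≡i (to (first-step⇔Balanced {h} {H} h≗H (Fin.fromℕ< i<n))
              (step (Fin.fromℕ< i<n) (λ u≡vd → i≢t (trans (sym u≡i) (trans (cong toℕ u≡vd) vd≡t)))))
        }
      hitting-time : HittingEquations m t′ H → IsHittingTimeTo G vd h
      hitting-time E =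
        trans (h≗H vd) (trans (cong H vd≡t) at-target) ,
        λ u u≢vd → from (first-step⇔Balanced {h} {H} h≗H u)
          (balanced (toℕ u) (Finₚ.toℕ<n u) (λ u≡t → u≢vd (Finₚ.toℕ-injective (trans u≡t (sym vd≡t)))))
        where open HittingEquations E

    rightLeaf-offset : ∀ vd → IsRightLeaf (suc (suc m)) ℓ r vd → ∃ λ t′ → t′ < r × toℕ vd ≡ target m t′
    rightLeaf-offset vd vd-right = t′ , t′<r , sym target≡t
      where
      t = toℕ vd
      m+ℓ<t : m ℕ.+ ℓ < t
      m+ℓ<t = ℕₚ.<ᵇ⇒< (m ℕ.+ ℓ) t (from T-≡ vd-right)
      t′ = t ℕ.∸ suc (m ℕ.+ ℓ)
      target≡t : target m t′ ≡ t
      target≡t = ℕₚ.m+[n∸m]≡n m+ℓ<t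
      t′<r : t′ < r
      t′<r = ℕₚ.+-cancelˡ-< (suc m ℕ.+ ℓ) t′ r (subst (_< size m) (sym target≡t) (Finₚ.toℕ<n vd))

    Hπ-formula : ∀ {h : Fin (size m) → ℚ} {H : ℕ → ℚ} {t′} →
      t′ < r → (∀ w → h w ≡ H (toℕ w)) → ExplicitForm m t′ H →
      Hπ G h ≡ broomFormula (suc (suc m)) ℓ r
    Hπ-formula {h} {H} t′<r h≗H X = sym (divℕ-unique _ K (Hπ G h) K≢0 (begin
      Hπ G h * ℕtoℚ K
        ≡⟨ cong (Hπ G h *_) (trans (sym (degreeSum m)) (cong (ℕtoℚ 3 *_) (sym twiceEdges≡))) ⟩
      Hπ G h * (ℕtoℚ 3 * ℕtoℚ (twiceEdges G))
        ≡⟨ x*[a*b]≡a*[x*b] (Hπ G h) (ℕtoℚ 3) (ℕtoℚ (twiceEdges G)) ⟩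
      ℕtoℚ 3 * (Hπ G h * ℕtoℚ (twiceEdges G))
        ≡⟨ cong (ℕtoℚ 3 *_) (divℕ-*-cancel _ (twiceEdges G) twiceEdges≢0) ⟩
      ℕtoℚ 3 * sumℚ (λ u → ℕtoℚ (deg G u) * h u)
        ≡⟨ cong (ℕtoℚ 3 *_) weighted≡ ⟩
      ℕtoℚ 3 * sumBelow (size m) (λ j → degree m j * H j)
        ≡⟨ explicit-weightedDegreeSum t′<r X ⟩
      evalℚ broomNumeratorPoly (ℕtoℚ (suc (suc m))) L (ℕtoℚ r)
        ≡⟨ ℤtoℚ-broomNumerator (suc (suc m)) ℓ r ⟨
      ℤtoℚ (broomNumerator (suc (suc m)) ℓ r) ∎))
      where
      open ≡-Reasoning
      K = 6 ℕ.* (m ℕ.+ ℓ ℕ.+ r)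
      twiceEdges≡ : ℕtoℚ (twiceEdges G) ≡ sumBelow (size m) (degree m)
      twiceEdges≡ = trans (ℕtoℚ-sumℕ (deg G)) (sumℚ≡sumBelow _ (degree m) ℕtoℚ-deg)
      weighted≡ : sumℚ (λ u → ℕtoℚ (deg G u) * h u) ≡ sumBelow (size m) (λ j → degree m j * H j)
      weighted≡ = sumℚ≡sumBelow _ (λ j → degree m j * H j) (λ u → cong₂ _*_ (ℕtoℚ-deg u) (h≗H u))
      K≢0 : ℕtoℚ K ≢ 0ℚ
      K≢0 = subst (λ k → ℕtoℚ (6 ℕ.* k) ≢ 0ℚ) (sym (ℕₚ.+-suc (m ℕ.+ ℓ) r′))
                  (ℕtoℚ-suc≢0 (m ℕ.+ ℓ ℕ.+ r′ ℕ.+ 5 ℕ.* suc (m ℕ.+ ℓ ℕ.+ r′)))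
      twiceEdges≢0 : ℕtoℚ (twiceEdges G) ≢ 0ℚ
      twiceEdges≢0 2|E|≡0 = K≢0 (trans (sym (degreeSum m))
        (trans (cong (ℕtoℚ 3 *_) (trans (sym twiceEdges≡) 2|E|≡0)) (ℚₚ.*-zeroʳ (ℕtoℚ 3))))
      x*[a*b]≡a*[x*b] : ∀ x a b → x * (a * b) ≡ a * (x * b)
      x*[a*b]≡a*[x*b] = RingSolver.solve-∀ ℚ-ring

lemma3p2 : (d ℓ r : ℕ) → 2 ≤ d → 1 ≤ ℓ → 1 ≤ r →
    (vd : Fin (broomSize d ℓ r)) → IsRightLeaf d ℓ r vd →
    (∃ λ (h : Fin (broomSize d ℓ r) → ℚ) → IsHittingTimeTo (doubleBroom d ℓ r) vd h) ×
    (∀ (h : Fin (broomSize d ℓ r) → ℚ) → IsHittingTimeTo (doubleBroom d ℓ r) vd h →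
      Hπ (doubleBroom d ℓ r) h ≡ broomFormula d ℓ r)
lemma3p2 (suc (suc m)) ℓ (suc r′) (s≤s (s≤s z≤n)) _ (s≤s z≤n) vd vd-right =
  let open Hitting ℓ r′
      (t′ , t′<r , vd≡target) = rightLeaf-offset m vd vd-right
      hits⇔ : ∀ {h : Fin (size m) → ℚ} {H : ℕ → ℚ} → (∀ w → h w ≡ H (toℕ w)) →
        IsHittingTimeTo (doubleBroom (suc (suc m)) ℓ r) vd h ⇔ ExplicitForm m t′ H
      hits⇔ h≗H = ⇔-trans (IsHittingTimeTo⇔HittingEquations m h≗H vd≡target) (HittingEquations⇔ExplicitForm t′<r)
  in ((λ w → candidate m (target m t′) (toℕ w)) , from (hits⇔ (λ _ → refl)) (candidate-explicit m t′)) ,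
     (λ h h-hits → Hπ-formula m t′<r (lift-toℕ m h) (to (hits⇔ {h} {lift m h} (lift-toℕ m h)) h-hits))
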